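{- Let $n\ge 2$ be even and let $M\in\mathcal{M}_n$ have non-zero weight. If $w(M)>0$, then all visible edges of $M$ are positive, and for every visible edge $e\in M$ we have $w(M_e)=w(\varphi(M_e^-))$. If $w(M)<0$, then all visible edges of $M$ are negative, and for every visible edge $e\in M$ we have $w(M_e)=-w(\varphi(M_e^-))$.
   Context: Place $2n$ points equidistantly on the unit circle, labeled $1,\ldots,2n$ in clockwise order; $\mathcal{M}_n$ is the set of non-crossing straight-line perfect matchings on them. For $M\in\mathcal{M}_n$ and $e\in M$, the length $\ell(e)$ is the minimum, over the two sides of the line through $e$, of the number of other edges of $M$ on that side. Write the endpoints of $e$ as $i,j$ such that the circle center lies to the right of the ray from $i$ to $j$; $\mathrm{sgn}(e)=+1$ (positive edge) if $i$ is odd and $-1$ (negative edge) if $i$ is even. The weight is $w(M)=\sum_{e\in M}\mathrm{sgn}(e)\ell(e)$. An edge $e\in M$ is visible if the two rays from the center to its endpoints cross no other edge of $M$. A point is hidden behind $e$ if it is not an endpoint of $e$ and the ray from the center to it crosses $e$; an edge is hidden behind $e$ if both its endpoints are. For a visible edge $e$, the segment $M_e$ is the set consisting of $e$ and all edges of $M$ hidden behind $e$, and $M_e^-:=M_e\setminus\{e\}$; $w(M_e):=\sum_{f\in M_e}\mathrm{sgn}(f)\ell(f)$ with sign and length taken in $M$. A Dyck path with $2m$ steps is a lattice path from the origin with $m$ upsteps $(+1,+1)$ and $m$ downsteps $(+1,-1)$ never going below $y=0$. For a set of pairwise non-crossing edges perfectly matching a set of points on the circle, $\varphi$ of it is the Dyck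 path obtained by traversing these points in order (for $M_e^-$: the points hidden behind $e$, in clockwise order from $i$ towards $j$) and recording an upstep at the first-encountered endpoint of each edge and a downstep at the second. The band-weight $w(x)$ of a Dyck path $x$ is the number of its upsteps lying in one of the horizontal strips $\mathbb{R}\times[2k,2k+1]$, $k=0,1,2,\ldots$. -}

module Defs where

open import Data.Nat as ℕ using (ℕ; zero; suc; _+_; _*_; _∸_; _<_; _⊓_; _⊔_; _≤ᵇ_; _<ᵇ_; _≡ᵇ_; _%_)
open import Data.Fin using (Fin; toℕ)
open import Data.Integer as ℤ using (ℤ; +_; -_)
open import Data.Bool using (Bool; true; false; if_then_else_; _∧_; not)
open import Data.List using (List; []; _∷_; map; length; _++_; foldr; allFin)
open import Data.Product using (_×_)
open import Relation.Binary.PropositionalEquality using (_≡_; _≢_)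
open import Relation.Nullary using (¬_)

-- Points are indexed by Fin (2n); index k is the point with label k+1
-- (labels 1..2n in clockwise order).  A matching is a fixed-point-free
-- involution m; the edges are the pairs {x , m x}.

keep : {A : Set} → (A → Bool) → List A → List A
keep p [] = []
keep p (x ∷ xs) = if p x then x ∷ keep p xs else keep p xs

sumℤ : List ℤ → ℤ
sumℤ = foldr ℤ._+_ (+ 0)

-- Band-weight of a Dyck path (true = upstep, false = downstep):
-- number of upsteps starting at an even height, i.e. lying in a strip
-- ℝ × [2k, 2k+1].
bw : ℕ → List Bool → ℕ
bw h [] = 0
bw h (true ∷ s) = (if h % 2 ≡ᵇ 0 then 1 else 0) + bw (suc h) s
bw h (false ∷ s) = bw (h ∸ 1) s

bandWeight : List Bool → ℕ
bandWeight = bw 0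

-- Perfect matching on the 2n points, non-crossing as straight chords
-- (chords of points in convex position cross iff endpoints interleave).
IsNCPM : (n : ℕ) → (Fin (2 * n) → Fin (2 * n)) → Set
IsNCPM n m =
  (∀ x → m (m x) ≡ x) × (∀ x → m x ≢ x) ×
  (∀ x y → ¬ ( (toℕ x ⊓ toℕ (m x)) < (toℕ y ⊓ toℕ (m y))
             × (toℕ y ⊓ toℕ (m y)) < (toℕ x ⊔ toℕ (m x))
             × (toℕ x ⊔ toℕ (m x)) < (toℕ y ⊔ toℕ (m y)) ))

module _ (n : ℕ) (m : Fin (2 * n) → Fin (2 * n)) where

  pts : List (Fin (2 * n))
  pts = allFin (2 * n)

  cw : ℕ → ℕ → ℕ
  cw a b = if a ≤ᵇ b then b ∸ a else (b + 2 * n) ∸ a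

  -- For the edge {x, m x}: its endpoint i such that the centre lies to
  -- the right of the ray i → j, i.e. the clockwise arc from i to j is the
  -- short one.  (Diameters cannot occur for n even.)
  tailE : Fin (2 * n) → Fin (2 * n)
  tailE x = if cw (toℕ x) (toℕ (m x)) <ᵇ n then x else m x

  headE : Fin (2 * n) → Fin (2 * n)
  headE x = m (tailE x)

  hidden : Fin (2 * n) → Fin (2 * n) → Bool
  hidden x p = (0 <ᵇ cw t (toℕ p)) ∧ (cw t (toℕ p) <ᵇ cw t (toℕ (headE x)))
    where t = toℕ (tailE x)

  -- p lies strictly on the other side of the line through {x, m x}
  outside : Fin (2 * n) → Fin (2 * n) → Bool
  outside x p = cw t (toℕ (headE x)) <ᵇ cw t (toℕ p)
    where t = toℕ (tailE x)

  isRep : Fin (2 * n) → Bool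
  isRep y = toℕ y <ᵇ toℕ (m y)

  countEdges : (Fin (2 * n) → Bool) → ℕ
  countEdges P = length (keep (λ y → isRep y ∧ P y ∧ P (m y)) pts)

  len : Fin (2 * n) → ℕ
  len x = countEdges (hidden x) ⊓ countEdges (outside x)

  -- sign: +1 iff the label toℕ (tailE x) + 1 is odd
  sgn : Fin (2 * n) → ℤ
  sgn x = if toℕ (tailE x) % 2 ≡ᵇ 0 then + 1 else - (+ 1)

  signedLen : Fin (2 * n) → ℤ
  signedLen x = sgn x ℤ.* (+ len x)

  weight : ℤ
  weight = sumℤ (map signedLen (keep isRep pts))

  -- the edge {x, m x} is visible: no ray to one of its endpoints
  -- crosses another edge (i.e. neither endpoint is hidden behind an edge)
  Visible : Fin (2 * n) → Set
  Visible x = ∀ y → (hidden y x ≡ false) × (hidden y (m x) ≡ false)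

  segWeight : Fin (2 * n) → ℤ
  segWeight x = signedLen x ℤ.+
    sumℤ (map signedLen (keep (λ y → isRep y ∧ hidden x y ∧ hidden x (m y)) pts))

  -- φ(M_e^-): hidden points traversed clockwise from i = tailE x;
  -- upstep at a point iff its partner comes later in the traversal.
  phiSeg : Fin (2 * n) → List Bool
  phiSeg x = map (λ p → cw t (toℕ p) <ᵇ cw t (toℕ (m p)))
                 (keep (hidden x) (keep (λ p → t <ᵇ toℕ p) pts ++ keep (λ p → toℕ p ≤ᵇ t) pts))
    where t = toℕ (tailE x)

module Submission where

-- Write ν(g) ∈ {0, 1} for the indicator that the edge g is negative and cover(g) for the signed
-- number of edges hiding g.  Sweeping around the circle, the signed number of chords straddling a
-- position only depends on the parity of that position; this yields cover(g) + C = ν(g) for a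
-- constant C.  A visible edge r is hidden by no edge, hence C = ν(r) and cover(g) = ν(g) − ν(r).
-- Double counting gives w(M) = Σ_g cover(g), whose terms all have the sign of −ν(r), so the sign
-- of w(M) forces the sign of every visible edge.  The same double counting inside the segment of
-- r gives w(M_r) = Σ_{g behind r} (ν(g) − ν(r)) = sgn(r) · #{g behind r : tail(g) ≢ tail(r) mod 2}.
-- Finally, φ(M_r⁻) read from the tail of r never goes below 0, so an upstep lies in an even band
-- iff it sits at an odd distance from the tail of r; these upsteps are exactly the ones counted.

open import Data.Nat using (ℕ; _*_)
open import Data.Fin using (Fin)
open import Data.Bool using (true)
open import Relation.Binary.PropositionalEquality using (_≡_)
open import Defs

module Arithmetic where

  open import Data.Nat as ℕ using (ℕ; zero; suc; _+_; _∸_; _≤_; _<_; _≤ᵇ_; _<ᵇ_; _≡ᵇ_; _%_; z≤n; s≤s)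
  import Data.Nat.Properties as ℕP
  open import Data.Nat.Divisibility using (_∣_; divides)
  open import Data.Nat.DivMod using (m*n%n≡0)
  open import Data.Integer as ℤ using (ℤ; +_; -_)
  import Data.Integer.Properties as ℤP
  open import Data.Bool using (Bool; true; false; if_then_else_; _∧_; _∨_; not; _xor_; T)
  open import Data.Bool.Properties using (∧-zeroʳ)
  open import Data.Fin as F using (Fin; toℕ)
  import Data.Fin.Properties as FP
  open import Data.Fin.Permutation using (permutation)
  open import Data.List using (map; length; tabulate)
  open import Data.Product using (_×_; _,_)
  open import Data.Unit using (tt)
  open import Data.Empty using (⊥-elim)
  open import Function using (_∘_; case_of_)
  open import Relation.Binary using (tri<; tri≈; tri>)
  open import Relation.Binary.PropositionalEquality
  open import Data.Integer.Tactic.RingSolver using (solve-∀)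
  open import Algebra.Properties.Semiring.Sum ℤP.+-*-semiring using (sum; sum-cong-≗; ∑-distrib-+; ∑-comm; sum-permute; *-distribˡ-sum)

  if-cong : ∀ (s : Bool) {A : Set} {x y x′ y′ : A} → x ≡ x′ → y ≡ y′ → (if s then x else y) ≡ (if s then x′ else y′)
  if-cong true e _ = e
  if-cong false _ e = e

  ∧-true⁻¹ : ∀ {x y} → x ∧ y ≡ true → (x ≡ true) × (y ≡ true)
  ∧-true⁻¹ {true} {true} _ = refl , refl

  <ᵇ-true : ∀ {a b} → a < b → (a <ᵇ b) ≡ true
  <ᵇ-true {a} {b} p with a <ᵇ b | ℕP.<⇒<ᵇ p
  ... | true | _ = refl

  <ᵇ-true⁻¹ : ∀ {a b} → (a <ᵇ b) ≡ true → a < b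
  <ᵇ-true⁻¹ {a} {b} e = ℕP.<ᵇ⇒< a b (subst T (sym e) tt)

  <ᵇ-false : ∀ {a b} → b ≤ a → (a <ᵇ b) ≡ false
  <ᵇ-false {a} {b} p with a <ᵇ b in e
  ... | true = ⊥-elim (ℕP.<⇒≱ (<ᵇ-true⁻¹ e) p)
  ... | false = refl

  <ᵇ-false⁻¹ : ∀ {a b} → (a <ᵇ b) ≡ false → b ≤ a
  <ᵇ-false⁻¹ e = ℕP.≮⇒≥ λ p → case trans (sym (<ᵇ-true p)) e of λ ()

  ≤ᵇ-true : ∀ {a b} → a ≤ b → (a ≤ᵇ b) ≡ true
  ≤ᵇ-true {a} {b} p with a ≤ᵇ b | ℕP.≤⇒≤ᵇ p
  ... | true | _ = refl

  ≤ᵇ-true⁻¹ : ∀ {a b} → (a ≤ᵇ b) ≡ true → a ≤ b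
  ≤ᵇ-true⁻¹ {a} {b} e = ℕP.≤ᵇ⇒≤ a b (subst T (sym e) tt)

  ≤ᵇ-false : ∀ {a b} → b < a → (a ≤ᵇ b) ≡ false
  ≤ᵇ-false {a} {b} p with a ≤ᵇ b in e
  ... | true = ⊥-elim (ℕP.<⇒≱ p (≤ᵇ-true⁻¹ e))
  ... | false = refl

  ≡ᵇ-true : ∀ {a b} → a ≡ b → (a ≡ᵇ b) ≡ true
  ≡ᵇ-true {a} {b} p with a ≡ᵇ b | ℕP.≡⇒≡ᵇ a b p
  ... | true | _ = refl

  ≡ᵇ-true⁻¹ : ∀ {a b} → (a ≡ᵇ b) ≡ true → a ≡ b
  ≡ᵇ-true⁻¹ {a} {b} e = ℕP.≡ᵇ⇒≡ a b (subst T (sym e) tt)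

  ≡ᵇ-false : ∀ {a b} → a ≢ b → (a ≡ᵇ b) ≡ false
  ≡ᵇ-false {a} {b} p with a ≡ᵇ b in e
  ... | true = ⊥-elim (p (≡ᵇ-true⁻¹ e))
  ... | false = refl

  <ᵇ-cong : ∀ {a b c d} → (a < b → c < d) → (c < d → a < b) → (a <ᵇ b) ≡ (c <ᵇ d)
  <ᵇ-cong {a} {b} {c} {d} f g with a <ᵇ b in e₁ | c <ᵇ d in e₂
  ... | true | true = refl
  ... | false | false = refl
  ... | true | false = ⊥-elim (ℕP.<⇒≱ (f (<ᵇ-true⁻¹ e₁)) (<ᵇ-false⁻¹ e₂))
  ... | false | true = ⊥-elim (ℕP.<⇒≱ (g (<ᵇ-true⁻¹ e₂)) (<ᵇ-false⁻¹ e₁))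

  <ᵇ-∸ : ∀ {c x y} → c ≤ x → c ≤ y → (x ∸ c <ᵇ y ∸ c) ≡ (x <ᵇ y)
  <ᵇ-∸ {c} {x} {y} c≤x c≤y = <ᵇ-cong cancel (λ p → ℕP.∸-monoˡ-< p c≤x)
    where
    cancel : x ∸ c < y ∸ c → x < y
    cancel p = ℕP.≰⇒> (λ y≤x → ℕP.<⇒≱ p (ℕP.∸-monoˡ-≤ c y≤x))

  <ᵇ-flip : ∀ a b → a ≢ b → (b <ᵇ a) ≡ not (a <ᵇ b)
  <ᵇ-flip a b a≢b with ℕP.<-cmp a b
  ... | tri< a<b _ _ rewrite <ᵇ-true a<b = <ᵇ-false (ℕP.<⇒≤ a<b)
  ... | tri≈ _ a≡b _ = ⊥-elim (a≢b a≡b)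
  ... | tri> _ _ b<a rewrite <ᵇ-false (ℕP.<⇒≤ b<a) = <ᵇ-true b<a

  <ᵇ-complement : ∀ n d → d ≢ n → d ≤ n + n → ((n + n ∸ d) <ᵇ n) ≡ not (d <ᵇ n)
  <ᵇ-complement n d d≢n d≤2n with ℕP.<-cmp d n
  ... | tri< d<n _ _ rewrite <ᵇ-true d<n =
    <ᵇ-false (subst (_≤ (n + n) ∸ d) (ℕP.m+n∸n≡m n n) (ℕP.∸-monoʳ-≤ (n + n) (ℕP.<⇒≤ d<n)))
  ... | tri≈ _ d≡n _ = ⊥-elim (d≢n d≡n)
  ... | tri> _ _ n<d rewrite <ᵇ-false (ℕP.<⇒≤ n<d) =
    <ᵇ-true (subst ((n + n) ∸ d <_) (ℕP.m+n∸n≡m n n) (ℕP.∸-monoʳ-< n<d d≤2n))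

  m+m≤n+n⇒m≤n : ∀ a b → a + a ≤ b + b → a ≤ b
  m+m≤n+n⇒m≤n a b h = ℕP.≮⇒≥ λ b<a → ℕP.<⇒≱ (ℕP.+-mono-< b<a b<a) h

  short-side-≤ : ∀ i o n → i + o + 2 ≡ n + n → suc i < n → i ≤ o
  short-side-≤ i o n i+o+2≡n+n i+1<n = ℕP.≮⇒≥ λ o<i → ℕP.<⇒≱ (ℕP.m<n+m (suc (i + i)) {3} (s≤s z≤n)) (chain o<i)
    where
    chain : o < i → 3 + suc (i + i) ≤ suc (i + i)
    chain o<i = begin
      3 + suc (i + i)            ≡⟨ cong (suc ∘ suc) (sym (trans (ℕP.+-suc i (suc i)) (cong suc (ℕP.+-suc i i)))) ⟩
      suc (suc i) + suc (suc i)  ≤⟨ ℕP.+-mono-≤ i+1<n i+1<n ⟩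
      n + n                      ≡⟨ sym i+o+2≡n+n ⟩
      i + o + 2                  ≡⟨ ℕP.+-comm (i + o) 2 ⟩
      suc (suc (i + o))          ≤⟨ s≤s (subst (_≤ i + i) (ℕP.+-suc i o) (ℕP.+-monoʳ-≤ i o<i)) ⟩
      suc (i + i)                ∎
      where open ℕP.≤-Reasoning

  long-side-≥ : ∀ i o n → i + o + 2 ≡ n + n → n < suc i → o ≤ i
  long-side-≥ i o n i+o+2≡n+n n<i+1 = ℕP.≮⇒≥ λ i<o → ℕP.<-irrefl refl (chain i<o)
    where
    chain : i < o → suc (i + i) ≤ i + i
    chain i<o = begin
      suc (i + i)  ≡⟨ sym (ℕP.+-suc i i) ⟩
      i + suc i    ≤⟨ ℕP.+-monoʳ-≤ i i<o ⟩
      i + o        ≤⟨ ℕP.m≤m+n (i + o) 2 ⟩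
      i + o + 2    ≡⟨ i+o+2≡n+n ⟩
      n + n        ≤⟨ ℕP.+-mono-≤ (ℕP.≤-pred n<i+1) (ℕP.≤-pred n<i+1) ⟩
      i + i        ∎
      where open ℕP.≤-Reasoning

  ∸-nested-< : ∀ a₁ b₁ a₂ b₂ → a₁ < a₂ → b₂ < b₁ → a₂ < b₂ → b₂ ∸ a₂ < b₁ ∸ a₁
  ∸-nested-< a₁ b₁ a₂ b₂ a₁<a₂ b₂<b₁ a₂<b₂ =
    ℕP.<-≤-trans (ℕP.∸-monoˡ-< b₂<b₁ (ℕP.<⇒≤ a₂<b₂)) (ℕP.∸-monoʳ-≤ b₁ (ℕP.<⇒≤ a₁<a₂))

  even : ℕ → Bool
  even k = k % 2 ≡ᵇ 0

  even-suc : ∀ k → even (suc k) ≡ not (even k)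
  even-suc zero = refl
  even-suc (suc zero) = refl
  even-suc (suc (suc k)) = even-suc k

  even-double+ : ∀ j a → even (j + j + a) ≡ even a
  even-double+ zero a = refl
  even-double+ (suc j) a rewrite ℕP.+-suc j j = even-double+ j a

  even-+ : ∀ a b → even (a + b) ≡ not (even a xor even b)
  even-+ zero b with even b
  ... | true = refl
  ... | false = refl
  even-+ (suc a) b rewrite even-suc (a + b) | even-suc a | even-+ a b with even a | even b
  ... | true | true = refl
  ... | true | false = refl
  ... | false | true = refl
  ... | false | false = refl

  even-if-2∣ : ∀ {n} → 2 ∣ n → even n ≡ true
  even-if-2∣ (divides q refl) = cong (_≡ᵇ 0) (m*n%n≡0 q 2)

  signOf : ℕ → ℤ
  signOf k = if even k then + 1 else - (+ 1)

  ±1-not : ∀ b → (if not b then + 1 else - (+ 1)) ≡ - (if b then + 1 else - (+ 1))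
  ±1-not true = refl
  ±1-not false = refl

  𝟙 : Bool → ℤ
  𝟙 true = + 1
  𝟙 false = + 0

  𝟙-nonneg : ∀ b → + 0 ℤ.≤ 𝟙 b
  𝟙-nonneg true = ℤ.+≤+ z≤n
  𝟙-nonneg false = ℤ.+≤+ z≤n

  𝟙-not-difference : ∀ e e₀ → 𝟙 (not e) ℤ.- 𝟙 (not e₀) ≡ (if e₀ then + 1 else - (+ 1)) ℤ.* 𝟙 (e xor e₀)
  𝟙-not-difference true true = refl
  𝟙-not-difference true false = refl
  𝟙-not-difference false true = refl
  𝟙-not-difference false false = refl

  ifz : Bool → ℤ → ℤ
  ifz b x = if b then x else + 0

  ifz-∧false : ∀ c e → ifz (c ∧ false) e ≡ + 0
  ifz-∧false c e = cong (λ b → ifz b e) (∧-zeroʳ c)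

  ifz-neg : ∀ c e → ifz c (- e) ≡ - ifz c e
  ifz-neg true e = refl
  ifz-neg false e = refl

  ifz-* : ∀ b s d → ifz b (s ℤ.* d) ≡ s ℤ.* ifz b d
  ifz-* true s d = refl
  ifz-* false s d = sym (ℤP.*-zeroʳ s)

  ifz-split : ∀ a q (f : ℤ) → ifz q f ≡ ifz (a ∧ q) f ℤ.+ ifz (not a ∧ q) f
  ifz-split true true f = sym (ℤP.+-identityʳ f)
  ifz-split false true f = sym (ℤP.+-identityˡ f)
  ifz-split true false f = refl
  ifz-split false false f = refl

  straddle-step : ∀ a b k e →
    ifz ((a <ᵇ suc k) ∧ (suc k ≤ᵇ b)) e ℤ.+ ifz ((a <ᵇ k) ∧ (b ≡ᵇ k)) e
      ≡ ifz ((a <ᵇ k) ∧ (k ≤ᵇ b)) e ℤ.+ ifz ((a ≡ᵇ k) ∧ (k <ᵇ b)) e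
  straddle-step a b k e with ℕP.<-cmp a k
  ... | tri< a<k _ _ rewrite <ᵇ-true a<k | <ᵇ-true (ℕP.<-trans a<k (ℕP.n<1+n k)) | ≡ᵇ-false (ℕP.<⇒≢ a<k) with ℕP.<-cmp b k
  ...   | tri< b<k _ _ rewrite ≤ᵇ-false {k} b<k | <ᵇ-false {k} {b} (ℕP.<⇒≤ b<k) | ≡ᵇ-false (ℕP.<⇒≢ b<k) = refl
  ...   | tri≈ _ refl _ rewrite ≤ᵇ-true {b} ℕP.≤-refl | <ᵇ-false {b} {b} ℕP.≤-refl | ≡ᵇ-true {b} refl = ℤP.+-comm (+ 0) e
  ...   | tri> _ _ k<b rewrite ≤ᵇ-true (ℕP.<⇒≤ k<b) | <ᵇ-true k<b | ≡ᵇ-false (ℕP.>⇒≢ k<b) = refl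
  straddle-step a b k e | tri≈ _ refl _ rewrite <ᵇ-true (ℕP.n<1+n a) | <ᵇ-false {a} {a} ℕP.≤-refl | ≡ᵇ-true {a} refl =
    ℤP.+-comm (ifz (a <ᵇ b) e) (+ 0)
  straddle-step a b k e | tri> _ _ k<a
    rewrite <ᵇ-false {a} {suc k} k<a | <ᵇ-false {a} {k} (ℕP.<⇒≤ k<a) | ≡ᵇ-false (ℕP.>⇒≢ k<a) = refl

  one-of-four : ∀ I O E₁ E₂ e → 𝟙 I ℤ.+ 𝟙 O ℤ.+ 𝟙 E₁ ℤ.+ 𝟙 E₂ ≡ + 1 →
    ifz O (- e) ℤ.+ e ≡ ifz I e ℤ.+ ifz (E₁ ∨ E₂) e
  one-of-four true false false false e _ = trans (ℤP.+-identityˡ e) (sym (ℤP.+-identityʳ e))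
  one-of-four false true false false e _ = ℤP.+-inverseˡ e
  one-of-four false false true false e _ = refl
  one-of-four false false false true e _ = refl
  one-of-four true true true true e ()
  one-of-four true true true false e ()
  one-of-four true true false true e ()
  one-of-four true true false false e ()
  one-of-four true false true true e ()
  one-of-four true false true false e ()
  one-of-four true false false true e ()
  one-of-four false true true true e ()
  one-of-four false true true false e ()
  one-of-four false true false true e ()
  one-of-four false false true true e ()
  one-of-four false false false false e ()

  halve : ∀ a b → a ℤ.+ a ≡ b ℤ.+ b → a ≡ b
  halve a b e = ℤP.*-cancelˡ-≡ (+ 2) a b (trans (double a) (trans e (sym (double b))))
    where
    double : ∀ z → + 2 ℤ.* z ≡ z ℤ.+ z
    double = solve-∀

  sum-zero : ∀ {k} (f : Fin k → ℤ) → (∀ i → f i ≡ + 0) → sum f ≡ + 0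
  sum-zero {zero} f h = refl
  sum-zero {suc k} f h rewrite h F.zero | sum-zero (f ∘ F.suc) (h ∘ F.suc) = refl

  sum-ifz : ∀ {k} b (f : Fin k → ℤ) → sum (λ i → ifz b (f i)) ≡ ifz b (sum f)
  sum-ifz true f = refl
  sum-ifz {k} false f = sum-zero {k} _ (λ _ → refl)

  sum-single : ∀ {k} (f : Fin k → ℤ) (g : Fin k) → (∀ q → q ≢ g → f q ≡ + 0) → sum f ≡ f g
  sum-single {suc k} f F.zero h
    rewrite sum-zero (f ∘ F.suc) (λ i → h (F.suc i) (λ ())) = ℤP.+-identityʳ _
  sum-single {suc k} f (F.suc g) h
    rewrite h F.zero (λ ()) | sum-single (f ∘ F.suc) g (λ q q≢g → h (F.suc q) (q≢g ∘ FP.suc-injective)) =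
    ℤP.+-identityˡ _

  sum-nonneg : ∀ {k} (f : Fin k → ℤ) → (∀ i → + 0 ℤ.≤ f i) → + 0 ℤ.≤ sum f
  sum-nonneg {zero} f h = ℤP.≤-refl
  sum-nonneg {suc k} f h = ℤP.+-mono-≤ (h F.zero) (sum-nonneg (f ∘ F.suc) (h ∘ F.suc))

  sum-nonpos : ∀ {k} (f : Fin k → ℤ) → (∀ i → f i ℤ.≤ + 0) → sum f ℤ.≤ + 0
  sum-nonpos {zero} f h = ℤP.≤-refl
  sum-nonpos {suc k} f h = ℤP.+-mono-≤ (h F.zero) (sum-nonpos (f ∘ F.suc) (h ∘ F.suc))

  sum-involution : ∀ {k} (f : Fin k → ℤ) (σ : Fin k → Fin k) → (∀ x → σ (σ x) ≡ x) → sum f ≡ sum (f ∘ σ)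
  sum-involution f σ inv = sum-permute f (permutation σ σ inv inv)

  sumℤ-keep : ∀ {A : Set} {k} (P : A → Bool) (f : A → ℤ) (g : Fin k → A) →
    sumℤ (map f (keep P (tabulate g))) ≡ sum (λ i → ifz (P (g i)) (f (g i)))
  sumℤ-keep {k = zero} P f g = refl
  sumℤ-keep {k = suc k} P f g with P (g F.zero)
  ... | true = cong (ℤ._+_ (f (g F.zero))) (sumℤ-keep P f (g ∘ F.suc))
  ... | false = trans (sumℤ-keep P f (g ∘ F.suc)) (sym (ℤP.+-identityˡ _))

  length-keep : ∀ {A : Set} {k} (P : A → Bool) (g : Fin k → A) →
    + length (keep P (tabulate g)) ≡ sum (λ i → 𝟙 (P (g i)))
  length-keep {k = zero} P g = refl
  length-keep {k = suc k} P g with P (g F.zero)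
  ... | true = trans (ℤP.pos-+ 1 _) (cong (ℤ._+_ (+ 1)) (length-keep P (g ∘ F.suc)))
  ... | false = trans (length-keep P (g ∘ F.suc)) (sym (ℤP.+-identityˡ _))

  sumTo : ℕ → (ℕ → ℤ) → ℤ
  sumTo zero f = + 0
  sumTo (suc k) f = f 0 ℤ.+ sumTo k (f ∘ suc)

  sum≡sumTo : ∀ k (g : ℕ → ℤ) → sum {k} (g ∘ toℕ) ≡ sumTo k g
  sum≡sumTo zero g = refl
  sum≡sumTo (suc k) g = cong (ℤ._+_ (g 0)) (sum≡sumTo k (g ∘ suc))

  sumTo-cong : ∀ k {f g : ℕ → ℤ} → (∀ i → i < k → f i ≡ g i) → sumTo k f ≡ sumTo k g
  sumTo-cong zero h = refl
  sumTo-cong (suc k) h = cong₂ ℤ._+_ (h 0 (s≤s z≤n)) (sumTo-cong k (λ i lt → h (suc i) (s≤s lt)))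

  sumTo-zero : ∀ k (f : ℕ → ℤ) → (∀ i → i < k → f i ≡ + 0) → sumTo k f ≡ + 0
  sumTo-zero zero f h = refl
  sumTo-zero (suc k) f h rewrite h 0 (s≤s z≤n) =
    trans (ℤP.+-identityˡ _) (sumTo-zero k (f ∘ suc) (λ i lt → h (suc i) (s≤s lt)))

  sumTo-+ : ∀ a b (f : ℕ → ℤ) → sumTo (a + b) f ≡ sumTo a f ℤ.+ sumTo b (λ i → f (a + i))
  sumTo-+ zero b f = sym (ℤP.+-identityˡ _)
  sumTo-+ (suc a) b f =
    trans (cong (ℤ._+_ (f 0)) (sumTo-+ a b (f ∘ suc))) (sym (ℤP.+-assoc (f 0) (sumTo a (f ∘ suc)) _))

  sumTo-<ᵇ : ∀ k c → c ≤ k → sumTo k (λ j → 𝟙 (j <ᵇ c)) ≡ + c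
  sumTo-<ᵇ k zero _ = sumTo-zero k _ (λ { zero _ → refl ; (suc i) _ → refl })
  sumTo-<ᵇ (suc k) (suc c) (s≤s c≤k) = trans (cong (ℤ._+_ (+ 1)) (sumTo-<ᵇ k c c≤k)) (sym (ℤP.pos-+ 1 c))

open Arithmetic

module Ranges where

  open import Data.Nat as ℕ using (ℕ; zero; suc; _+_; _∸_; _≤_; _<_; _<ᵇ_)
  import Data.Nat.Properties as ℕP
  open import Data.Bool using (Bool; true; false)
  open import Data.Fin as F using (Fin; toℕ)
  open import Data.List using (List; []; _∷_; map; _++_; tabulate; allFin)
  open import Data.List.Properties using (++-identityʳ)
  open import Data.Product using (_×_; _,_)
  open import Function using (_∘_)
  open import Relation.Binary.PropositionalEquality

  range : ℕ → ℕ → List ℕ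
  range a zero = []
  range a (suc L) = a ∷ range (suc a) L

  range-++ : ∀ j a b → range j (a + b) ≡ range j a ++ range (j + a) b
  range-++ j zero b = cong (λ z → range z b) (sym (ℕP.+-identityʳ j))
  range-++ j (suc a) b =
    cong (j ∷_) (trans (range-++ (suc j) a b) (cong (λ z → range (suc j) a ++ range z b) (sym (ℕP.+-suc j a))))

  keep-++ : ∀ {A : Set} (P : A → Bool) xs ys → keep P (xs ++ ys) ≡ keep P xs ++ keep P ys
  keep-++ P [] ys = refl
  keep-++ P (x ∷ xs) ys with P x
  ... | true = cong (x ∷_) (keep-++ P xs ys)
  ... | false = keep-++ P xs ys

  keep-map : ∀ {A B : Set} (P : B → Bool) (f : A → B) xs → keep P (map f xs) ≡ map f (keep (P ∘ f) xs)
  keep-map P f [] = refl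
  keep-map P f (x ∷ xs) with P (f x)
  ... | true = cong (f x ∷_) (keep-map P f xs)
  ... | false = keep-map P f xs

  map-toℕ-tabulate : ∀ {N} k a (g : Fin k → Fin N) → (∀ i → toℕ (g i) ≡ a + toℕ i) →
    map toℕ (tabulate g) ≡ range a k
  map-toℕ-tabulate zero a g h = refl
  map-toℕ-tabulate (suc k) a g h = cong₂ _∷_ (trans (h F.zero) (ℕP.+-identityʳ a))
    (map-toℕ-tabulate k (suc a) (g ∘ F.suc) (λ i → trans (h (F.suc i)) (ℕP.+-suc a (toℕ i))))

  map-toℕ-allFin : ∀ k → map toℕ (allFin k) ≡ range 0 k
  map-toℕ-allFin k = map-toℕ-tabulate k 0 (λ i → i) (λ i → refl)

  map-+-range : ∀ a j L → map (_+_ a) (range j L) ≡ range (a + j) L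
  map-+-range a j zero = refl
  map-+-range a j (suc L) = cong ((a + j) ∷_) (trans (map-+-range a (suc j) L) (cong (λ z → range z L) (ℕP.+-suc a j)))

  map-∸-range : ∀ a L → map (_∸ a) (range a L) ≡ range 0 L
  map-∸-range a L = go 0 L
    where
    go : ∀ b L → map (_∸ a) (range (b + a) L) ≡ range b L
    go b zero = refl
    go b (suc L) = cong₂ _∷_ (ℕP.m+n∸n≡m b a) (go (suc b) L)

  private
    in-range-head : ∀ j L → j < j + suc L
    in-range-head j L = subst (j <_) (sym (ℕP.+-suc j L)) (ℕP.m≤m+n (suc j) L)

    in-range-tail : ∀ {j L k} → suc j ≤ k → k < suc j + L → (j ≤ k) × (k < j + suc L)
    in-range-tail {j} {L} {k} j<k k<e = ℕP.≤-trans (ℕP.n≤1+n j) j<k , subst (k <_) (sym (ℕP.+-suc j L)) k<e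

  map-cong-range : ∀ {B : Set} {f g : ℕ → B} j L → (∀ k → j ≤ k → k < j + L → f k ≡ g k) →
    map f (range j L) ≡ map g (range j L)
  map-cong-range j zero h = refl
  map-cong-range j (suc L) h = cong₂ _∷_ (h j ℕP.≤-refl (in-range-head j L))
    (map-cong-range (suc j) L (λ k p q → let (p′ , q′) = in-range-tail {j} {L} p q in h k p′ q′))

  keep-cong-range : ∀ {P Q : ℕ → Bool} j L → (∀ k → j ≤ k → k < j + L → P k ≡ Q k) →
    keep P (range j L) ≡ keep Q (range j L)
  keep-cong-range j zero h = refl
  keep-cong-range {P} {Q} j (suc L) h rewrite h j ℕP.≤-refl (in-range-head j L) with Q j
  ... | true = cong (j ∷_) (keep-cong-range (suc j) L (λ k p q → let (p′ , q′) = in-range-tail {j} {L} p q in h k p′ q′))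
  ... | false = keep-cong-range (suc j) L (λ k p q → let (p′ , q′) = in-range-tail {j} {L} p q in h k p′ q′)

  keep-all : ∀ {P : ℕ → Bool} j L → (∀ k → j ≤ k → k < j + L → P k ≡ true) → keep P (range j L) ≡ range j L
  keep-all j zero h = refl
  keep-all j (suc L) h rewrite h j ℕP.≤-refl (in-range-head j L) =
    cong (j ∷_) (keep-all (suc j) L (λ k p q → let (p′ , q′) = in-range-tail {j} {L} p q in h k p′ q′))

  keep-none : ∀ {P : ℕ → Bool} j L → (∀ k → j ≤ k → k < j + L → P k ≡ false) → keep P (range j L) ≡ []
  keep-none j zero h = refl
  keep-none j (suc L) h rewrite h j ℕP.≤-refl (in-range-head j L) =
    keep-none (suc j) L (λ k p q → let (p′ , q′) = in-range-tail {j} {L} p q in h k p′ q′)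

  keep-<ᵇ-range : ∀ c j L → j ≤ c → c ≤ j + L → keep (_<ᵇ c) (range j L) ≡ range j (c ∸ j)
  keep-<ᵇ-range c j L j≤c c≤e = begin
    keep (_<ᵇ c) (range j L)
      ≡⟨ cong (keep (_<ᵇ c) ∘ range j) (sym (ℕP.m+[n∸m]≡n c-j≤L)) ⟩
    keep (_<ᵇ c) (range j ((c ∸ j) + (L ∸ (c ∸ j))))
      ≡⟨ cong (keep (_<ᵇ c)) (range-++ j (c ∸ j) (L ∸ (c ∸ j))) ⟩
    keep (_<ᵇ c) (range j (c ∸ j) ++ range (j + (c ∸ j)) (L ∸ (c ∸ j)))
      ≡⟨ keep-++ (_<ᵇ c) (range j (c ∸ j)) _ ⟩
    keep (_<ᵇ c) (range j (c ∸ j)) ++ keep (_<ᵇ c) (range (j + (c ∸ j)) (L ∸ (c ∸ j)))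
      ≡⟨ cong₂ _++_ (keep-all j (c ∸ j) (λ k _ k<c → <ᵇ-true (subst (k <_) (ℕP.m+[n∸m]≡n j≤c) k<c)))
                    (keep-none (j + (c ∸ j)) (L ∸ (c ∸ j)) (λ k c≤k _ → <ᵇ-false (subst (_≤ k) (ℕP.m+[n∸m]≡n j≤c) c≤k))) ⟩
    range j (c ∸ j) ++ []
      ≡⟨ ++-identityʳ _ ⟩
    range j (c ∸ j) ∎
    where
    open ≡-Reasoning
    c-j≤L : c ∸ j ≤ L
    c-j≤L = ℕP.≤-trans (ℕP.∸-monoˡ-≤ j c≤e) (ℕP.≤-reflexive (ℕP.m+n∸m≡n j L))

open Ranges

module DyckWords where

  open import Data.Nat as ℕ using (ℕ; zero; suc; _+_; _∸_; _≤_; _<_; _≤ᵇ_; _<ᵇ_; _≡ᵇ_; z≤n; s≤s)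
  import Data.Nat.Properties as ℕP
  open import Data.Integer as ℤ using (ℤ; +_)
  import Data.Integer.Properties as ℤP
  open import Data.Bool using (Bool; true; false; if_then_else_; _∧_)
  open import Data.Bool.Properties using (∧-zeroʳ)
  open import Data.List using (List; []; _∷_; map)
  open import Data.Product using (_×_; _,_; proj₁)
  open import Data.Unit using (⊤; tt)
  open import Data.Empty using (⊥; ⊥-elim)
  open import Relation.Binary using (tri<; tri≈; tri>)
  open import Relation.Binary.PropositionalEquality
  open import Algebra.Properties.CommutativeSemigroup ℕP.+-commutativeSemigroup using (interchange)

  𝟙ℕ : Bool → ℕ
  𝟙ℕ b = if b then 1 else 0

  upstepsAtEven : ℕ → List Bool → ℕ
  upstepsAtEven h [] = 0
  upstepsAtEven h (s ∷ w) = 𝟙ℕ (s ∧ even h) + upstepsAtEven (suc h) w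

  StaysNonneg : ℕ → List Bool → Set
  StaysNonneg h [] = ⊤
  StaysNonneg h (true ∷ w) = StaysNonneg (suc h) w
  StaysNonneg zero (false ∷ w) = ⊥
  StaysNonneg (suc h) (false ∷ w) = StaysNonneg h w

  upstepsAtEven-+2 : ∀ h w → upstepsAtEven (suc (suc h)) w ≡ upstepsAtEven h w
  upstepsAtEven-+2 h [] = refl
  upstepsAtEven-+2 h (s ∷ w) = cong (_+_ (𝟙ℕ (s ∧ even h))) (upstepsAtEven-+2 (suc h) w)

  -- On a path that never goes below 0 the height of a step has the parity of its index,
  -- so the truncating subtraction in bw never fires.
  bw≡upstepsAtEven : ∀ h w → StaysNonneg h w → bw h w ≡ upstepsAtEven h w
  bw≡upstepsAtEven h [] _ = refl
  bw≡upstepsAtEven h (true ∷ w) nn = cong (_+_ _) (bw≡upstepsAtEven (suc h) w nn)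
  bw≡upstepsAtEven (suc h) (false ∷ w) nn = trans (bw≡upstepsAtEven h w nn) (sym (upstepsAtEven-+2 h w))

  upstepsAtEven-range : ∀ (g : ℕ → Bool) h j L →
    + upstepsAtEven h (map g (range j L)) ≡ sumTo L (λ i → 𝟙 (g (i + j) ∧ even (i + h)))
  upstepsAtEven-range g h j zero = refl
  upstepsAtEven-range g h j (suc L) =
    trans (ℤP.pos-+ (𝟙ℕ (g j ∧ even h)) _)
          (cong₂ ℤ._+_ (𝟙ℕ≡𝟙 (g j ∧ even h))
                       (trans (upstepsAtEven-range g (suc h) (suc j) L)
                              (sumTo-cong L (λ i _ → cong₂ (λ a b → 𝟙 (g a ∧ even b)) (ℕP.+-suc i j) (ℕP.+-suc i h)))))
    where
    𝟙ℕ≡𝟙 : ∀ b → + 𝟙ℕ b ≡ 𝟙 b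
    𝟙ℕ≡𝟙 true = refl
    𝟙ℕ≡𝟙 false = refl

  countBelow : ℕ → (ℕ → Bool) → ℕ
  countBelow zero P = 0
  countBelow (suc k) P = countBelow k P + 𝟙ℕ (P k)

  countBelow-zero : ∀ k (P : ℕ → Bool) → (∀ i → i < k → P i ≡ false) → countBelow k P ≡ 0
  countBelow-zero zero P h = refl
  countBelow-zero (suc k) P h rewrite h k ℕP.≤-refl =
    trans (ℕP.+-identityʳ _) (countBelow-zero k P (λ i l → h i (ℕP.m<n⇒m<1+n l)))

  countBelow-single : ∀ k d (P : ℕ → Bool) → (∀ i → i < k → i ≢ d → P i ≡ false) → (d < k → P d ≡ true) →
    countBelow k P ≡ 𝟙ℕ (d <ᵇ k)
  countBelow-single zero d P h₁ h₂ = cong 𝟙ℕ (sym (<ᵇ-false {d} {0} z≤n))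
  countBelow-single (suc k) d P h₁ h₂ with ℕP.<-cmp d k
  ... | tri< d<k _ _ rewrite h₁ k ℕP.≤-refl (λ e → ℕP.<-irrefl (sym e) d<k) | <ᵇ-true (ℕP.m<n⇒m<1+n d<k) =
    trans (ℕP.+-identityʳ _)
          (trans (countBelow-single k d P (λ i l → h₁ i (ℕP.m<n⇒m<1+n l)) (λ l → h₂ (ℕP.m<n⇒m<1+n l)))
                 (cong 𝟙ℕ (<ᵇ-true d<k)))
  ... | tri≈ _ refl _ rewrite h₂ ℕP.≤-refl | <ᵇ-true (ℕP.n<1+n d) =
    cong (_+ 1) (countBelow-zero d P (λ i l → h₁ i (ℕP.m<n⇒m<1+n l) (λ e → ℕP.<-irrefl e l)))
  ... | tri> _ _ k<d rewrite h₁ k ℕP.≤-refl (λ e → ℕP.<-irrefl e k<d) | <ᵇ-false {d} {suc k} k<d =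
    trans (ℕP.+-identityʳ _)
          (trans (countBelow-single k d P (λ i l → h₁ i (ℕP.m<n⇒m<1+n l)) (λ l → ⊥-elim (ℕP.<-asym l k<d)))
                 (cong 𝟙ℕ (<ᵇ-false {d} {k} (ℕP.<⇒≤ k<d))))

  countBelow-+ : ∀ k (P Q R : ℕ → Bool) → (∀ i → i < k → 𝟙ℕ (P i) + 𝟙ℕ (Q i) ≡ 𝟙ℕ (R i)) →
    countBelow k P + countBelow k Q ≡ countBelow k R
  countBelow-+ zero P Q R h = refl
  countBelow-+ (suc k) P Q R h =
    trans (interchange (countBelow k P) (𝟙ℕ (P k)) (countBelow k Q) (𝟙ℕ (Q k)))
          (cong₂ _+_ (countBelow-+ k P Q R (λ i l → h i (ℕP.m<n⇒m<1+n l))) (h k ℕP.≤-refl))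

  -- The word of a fixed-point-free involution μ of {1, …, c-1} (an arc diagram):
  -- an upstep at i iff i is the left end of its arc.
  module ArcWord (c : ℕ) (μ : ℕ → ℕ)
    (μ-range : ∀ k → 1 ≤ k → k < c → (1 ≤ μ k) × (μ k < c))
    (μ-involutive : ∀ k → 1 ≤ k → k < c → μ (μ k) ≡ k)
    (μ-fixfree : ∀ k → 1 ≤ k → k < c → μ k ≢ k) where

    opener : ℕ → Bool
    opener k = k <ᵇ μ k

    openAt : ℕ → ℕ → Bool
    openAt j i = (1 ≤ᵇ i) ∧ opener i ∧ (j ≤ᵇ μ i)

    closesAt : ℕ → ℕ → Bool
    closesAt j i = (1 ≤ᵇ i) ∧ opener i ∧ (μ i ≡ᵇ j)

    height : ℕ → ℕ
    height j = countBelow j (openAt j)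

    openAt-suc : ∀ j i → 𝟙ℕ (openAt (suc j) i) + 𝟙ℕ (closesAt j i) ≡ 𝟙ℕ (openAt j i)
    openAt-suc j i with 1 ≤ᵇ i | i <ᵇ μ i
    ... | false | _ = refl
    ... | true | false = refl
    ... | true | true with ℕP.<-cmp (μ i) j
    ...   | tri< μi<j _ _ rewrite ≤ᵇ-false {suc j} {μ i} (ℕP.<-trans μi<j (ℕP.n<1+n j)) | ≡ᵇ-false (ℕP.<⇒≢ μi<j)
                                | ≤ᵇ-false {j} {μ i} μi<j = refl
    ...   | tri≈ _ refl _ rewrite ≤ᵇ-false {suc (μ i)} {μ i} (ℕP.n<1+n (μ i)) | ≡ᵇ-true {μ i} refl
                                | ≤ᵇ-true {μ i} ℕP.≤-refl = refl
    ...   | tri> _ _ j<μi rewrite ≤ᵇ-true j<μi | ≡ᵇ-false (ℕP.>⇒≢ j<μi) | ≤ᵇ-true (ℕP.<⇒≤ j<μi) = refl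

    closing-count : ∀ j → 1 ≤ j → j < c → countBelow j (closesAt j) ≡ 𝟙ℕ (μ j <ᵇ j)
    closing-count j 1≤j j<c = countBelow-single j (μ j) (closesAt j) other partner
      where
      other : ∀ i → i < j → i ≢ μ j → closesAt j i ≡ false
      other i i<j i≢μj with 1 ≤ᵇ i in e₁
      ... | false = refl
      ... | true with μ i ≡ᵇ j in e₂
      ...   | false = ∧-zeroʳ (opener i)
      ...   | true = ⊥-elim (i≢μj (trans (sym (μ-involutive i (≤ᵇ-true⁻¹ e₁) (ℕP.<-trans i<j j<c)))
                                           (cong μ (≡ᵇ-true⁻¹ e₂))))
      partner : μ j < j → closesAt j (μ j) ≡ true
      partner μj<j rewrite ≤ᵇ-true (proj₁ (μ-range j 1≤j j<c)) | μ-involutive j 1≤j j<c | <ᵇ-true μj<j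
                         | ≡ᵇ-true {j} refl = refl

    height-step : ∀ j → 1 ≤ j → j < c → height (suc j) + 𝟙ℕ (μ j <ᵇ j) ≡ height j + 𝟙ℕ (opener j)
    height-step j 1≤j j<c = begin
      (countBelow j (openAt (suc j)) + 𝟙ℕ (openAt (suc j) j)) + 𝟙ℕ (μ j <ᵇ j)
        ≡⟨ cong (λ b → (countBelow j (openAt (suc j)) + 𝟙ℕ b) + 𝟙ℕ (μ j <ᵇ j)) last-open ⟩
      (countBelow j (openAt (suc j)) + 𝟙ℕ (opener j)) + 𝟙ℕ (μ j <ᵇ j)
        ≡⟨ ℕP.+-assoc (countBelow j (openAt (suc j))) _ _ ⟩
      countBelow j (openAt (suc j)) + (𝟙ℕ (opener j) + 𝟙ℕ (μ j <ᵇ j))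
        ≡⟨ cong (_+_ (countBelow j (openAt (suc j)))) (ℕP.+-comm (𝟙ℕ (opener j)) _) ⟩
      countBelow j (openAt (suc j)) + (𝟙ℕ (μ j <ᵇ j) + 𝟙ℕ (opener j))
        ≡⟨ sym (ℕP.+-assoc (countBelow j (openAt (suc j))) _ _) ⟩
      (countBelow j (openAt (suc j)) + 𝟙ℕ (μ j <ᵇ j)) + 𝟙ℕ (opener j)
        ≡⟨ cong (λ z → (countBelow j (openAt (suc j)) + z) + 𝟙ℕ (opener j)) (sym (closing-count j 1≤j j<c)) ⟩
      (countBelow j (openAt (suc j)) + countBelow j (closesAt j)) + 𝟙ℕ (opener j)
        ≡⟨ cong (_+ 𝟙ℕ (opener j)) (countBelow-+ j (openAt (suc j)) (closesAt j) (openAt j) (λ i _ → openAt-suc j i)) ⟩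
      height j + 𝟙ℕ (opener j) ∎
      where
      open ≡-Reasoning
      last-open : openAt (suc j) j ≡ opener j
      last-open rewrite ≤ᵇ-true 1≤j with j <ᵇ μ j
      ... | true = refl
      ... | false = refl

    height-down : ∀ j → 1 ≤ j → j < c → μ j < j → height j ≡ suc (height (suc j))
    height-down j 1≤j j<c μj<j = begin
      height j                            ≡⟨ sym (ℕP.+-identityʳ _) ⟩
      height j + 0                        ≡⟨ cong (λ b → height j + 𝟙ℕ b) (sym (<ᵇ-false (ℕP.<⇒≤ μj<j))) ⟩
      height j + 𝟙ℕ (opener j)            ≡⟨ sym (height-step j 1≤j j<c) ⟩
      height (suc j) + 𝟙ℕ (μ j <ᵇ j)      ≡⟨ cong (λ b → height (suc j) + 𝟙ℕ b) (<ᵇ-true μj<j) ⟩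
      height (suc j) + 1                  ≡⟨ ℕP.+-comm (height (suc j)) 1 ⟩
      suc (height (suc j))                ∎
      where open ≡-Reasoning

    height-up : ∀ j → 1 ≤ j → j < c → j < μ j → height (suc j) ≡ suc (height j)
    height-up j 1≤j j<c j<μj = begin
      height (suc j)                      ≡⟨ sym (ℕP.+-identityʳ _) ⟩
      height (suc j) + 0                  ≡⟨ cong (λ b → height (suc j) + 𝟙ℕ b) (sym (<ᵇ-false (ℕP.<⇒≤ j<μj))) ⟩
      height (suc j) + 𝟙ℕ (μ j <ᵇ j)      ≡⟨ height-step j 1≤j j<c ⟩
      height j + 𝟙ℕ (opener j)            ≡⟨ cong (λ b → height j + 𝟙ℕ b) (<ᵇ-true j<μj) ⟩
      height j + 1                        ≡⟨ ℕP.+-comm (height j) 1 ⟩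
      suc (height j)                      ∎
      where open ≡-Reasoning

    staysNonneg : ∀ L j → j + L ≡ c → 1 ≤ j → StaysNonneg (height j) (map opener (range j L))
    staysNonneg zero j _ _ = tt
    staysNonneg (suc L) j j+L≡c 1≤j = step
      where
      j<c : j < c
      j<c = subst (j <_) j+L≡c (ℕP.m<m+n j (s≤s z≤n))
      rest : StaysNonneg (height (suc j)) (map opener (range (suc j) L))
      rest = staysNonneg L (suc j) (trans (sym (ℕP.+-suc j L)) j+L≡c) (ℕP.≤-trans 1≤j (ℕP.n≤1+n j))
      step : StaysNonneg (height j) (map opener (range j (suc L)))
      step with ℕP.<-cmp j (μ j)
      ... | tri< j<μj _ _ rewrite <ᵇ-true j<μj =
        subst (λ h → StaysNonneg h (map opener (range (suc j) L))) (height-up j 1≤j j<c j<μj) rest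
      ... | tri≈ _ j≡μj _ = ⊥-elim (μ-fixfree j 1≤j j<c (sym j≡μj))
      ... | tri> _ _ μj<j rewrite <ᵇ-false (ℕP.<⇒≤ μj<j) | height-down j 1≤j j<c μj<j = rest

    bandWeight-arcWord : 1 ≤ c →
      + bw 0 (map opener (range 1 (c ∸ 1))) ≡ sumTo (c ∸ 1) (λ i → 𝟙 (opener (i + 1) ∧ even i))
    bandWeight-arcWord 1≤c =
      trans (cong +_ (bw≡upstepsAtEven 0 (map opener (range 1 (c ∸ 1))) (staysNonneg (c ∸ 1) 1 (ℕP.m+[n∸m]≡n 1≤c) ℕP.≤-refl)))
            (trans (upstepsAtEven-range opener 0 1 (c ∸ 1))
                   (sumTo-cong (c ∸ 1) (λ i _ → cong (λ z → 𝟙 (opener (i + 1) ∧ even z)) (ℕP.+-identityʳ i))))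

open DyckWords

module Clockwise (N : ℕ) where

  open import Data.Nat as ℕ using (ℕ; suc; _+_; _∸_; _≤_; _<_; _≤ᵇ_; _<ᵇ_; _%_; z≤n)
  import Data.Nat.Properties as ℕP
  open import Data.Nat.DivMod using (m<n⇒m%n≡m; m≤n⇒[n∸m]%m≡n%m; m%n<n; [m+n]%n≡m%n)
  open import Data.Integer as ℤ using (ℤ)
  open import Data.Bool using (Bool; true; false; if_then_else_; _∧_; _∨_; not; _xor_)
  open import Data.Bool.Properties using (∧-zeroʳ; ∧-identityʳ; ∨-identityʳ)
  open import Data.Fin as F using (Fin; toℕ)
  import Data.Fin.Properties as FP
  open import Data.Fin.Permutation using (permutation)
  open import Data.List using (List; map; _++_; allFin)
  open import Data.List.Properties using (map-++; map-injective; map-∘; map-cong; ++-identityʳ)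
  open import Function using (_∘_)
  open import Relation.Binary using (tri<; tri≈; tri>)
  open import Relation.Nullary using (yes; no)
  open import Relation.Binary.PropositionalEquality
  import Data.Integer.Properties as ℤP
  open import Algebra.Properties.Semiring.Sum ℤP.+-*-semiring using (sum; sum-permute)

  -- For N = 2 * n this is cw n m.
  cwd : ℕ → ℕ → ℕ
  cwd a b = if a ≤ᵇ b then b ∸ a else (b + N) ∸ a

  private
    0<ᵇ∸ : ∀ {a x} → a ≤ x → (0 <ᵇ x ∸ a) ≡ (a <ᵇ x)
    0<ᵇ∸ {a} {x} a≤x = trans (cong (_<ᵇ x ∸ a) (sym (ℕP.n∸n≡0 a))) (<ᵇ-∸ ℕP.≤-refl a≤x)

    ≤+N : ∀ {b} x → b ≤ N → b ≤ x + N
    ≤+N x b≤N = ℕP.≤-trans b≤N (ℕP.m≤n+m N x)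

  cwd-between : ∀ a b x → a < b → b ≤ N →
    ((0 <ᵇ cwd a x) ∧ (cwd a x <ᵇ cwd a b)) ≡ ((a <ᵇ x) ∧ (x <ᵇ b))
  cwd-between a b x a<b b≤N rewrite ≤ᵇ-true (ℕP.<⇒≤ a<b) with ℕP.<-cmp x a
  ... | tri< x<a _ _ rewrite ≤ᵇ-false x<a | <ᵇ-false {a} {x} (ℕP.<⇒≤ x<a)
                           | <ᵇ-false {(x + N) ∸ a} {b ∸ a} (ℕP.∸-monoˡ-≤ a (≤+N x b≤N)) = ∧-zeroʳ _
  ... | tri≈ _ refl _ rewrite ≤ᵇ-true (ℕP.≤-refl {x}) =
    cong₂ _∧_ (0<ᵇ∸ (ℕP.≤-refl {x})) (<ᵇ-∸ ℕP.≤-refl (ℕP.<⇒≤ a<b))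
  ... | tri> _ _ a<x rewrite ≤ᵇ-true (ℕP.<⇒≤ a<x) =
    cong₂ _∧_ (0<ᵇ∸ (ℕP.<⇒≤ a<x)) (<ᵇ-∸ (ℕP.<⇒≤ a<x) (ℕP.<⇒≤ a<b))

  cwd-beyond : ∀ a b x → a < b → b < N → x < N →
    (cwd a b <ᵇ cwd a x) ≡ ((x <ᵇ a) ∨ (b <ᵇ x))
  cwd-beyond a b x a<b b<N x<N rewrite ≤ᵇ-true (ℕP.<⇒≤ a<b) with ℕP.<-cmp x a
  ... | tri< x<a _ _ rewrite ≤ᵇ-false x<a | <ᵇ-true x<a =
    <ᵇ-true (ℕP.∸-monoˡ-< (ℕP.<-≤-trans b<N (ℕP.m≤n+m N x)) (ℕP.<⇒≤ a<b))
  ... | tri≈ _ refl _ rewrite ≤ᵇ-true (ℕP.≤-refl {x}) | <ᵇ-false {x} {x} ℕP.≤-refl = <ᵇ-∸ (ℕP.<⇒≤ a<b) ℕP.≤-refl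
  ... | tri> _ _ a<x rewrite ≤ᵇ-true (ℕP.<⇒≤ a<x) | <ᵇ-false {x} {a} (ℕP.<⇒≤ a<x) = <ᵇ-∸ (ℕP.<⇒≤ a<b) (ℕP.<⇒≤ a<x)

  cwd-between-rev : ∀ a b x → a < b → b < N → x < N →
    ((0 <ᵇ cwd b x) ∧ (cwd b x <ᵇ cwd b a)) ≡ ((x <ᵇ a) ∨ (b <ᵇ x))
  cwd-between-rev a b x a<b b<N x<N rewrite ≤ᵇ-false a<b with ℕP.<-cmp x b
  ... | tri< x<b _ _ rewrite ≤ᵇ-false x<b | <ᵇ-false {b} {x} (ℕP.<⇒≤ x<b)
      | <ᵇ-true {0} {(x + N) ∸ b}
          (subst (_< (x + N) ∸ b) (ℕP.n∸n≡0 b) (ℕP.∸-monoˡ-< (ℕP.<-≤-trans b<N (ℕP.m≤n+m N x)) ℕP.≤-refl)) =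
    trans (<ᵇ-∸ (≤+N x (ℕP.<⇒≤ b<N)) (≤+N a (ℕP.<⇒≤ b<N)))
          (trans (<ᵇ-cong (ℕP.+-cancelʳ-< N x a) (ℕP.+-monoˡ-< N)) (sym (∨-identityʳ _)))
  ... | tri≈ _ refl _ rewrite ≤ᵇ-true (ℕP.≤-refl {x}) | <ᵇ-false {x} {x} ℕP.≤-refl
      | <ᵇ-false {x} {a} (ℕP.<⇒≤ a<b) | ℕP.n∸n≡0 x = refl
  ... | tri> _ _ b<x rewrite ≤ᵇ-true (ℕP.<⇒≤ b<x) | <ᵇ-false {x} {a} (ℕP.<⇒≤ (ℕP.<-trans a<b b<x))
      | 0<ᵇ∸ (ℕP.<⇒≤ b<x) | <ᵇ-true b<x
      | <ᵇ-true {x ∸ b} {(a + N) ∸ b} (ℕP.∸-monoˡ-< (ℕP.<-≤-trans x<N (ℕP.m≤n+m N a)) (ℕP.<⇒≤ b<x)) = refl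

  cwd-beyond-rev : ∀ a b x → a < b → b < N → x < N →
    (cwd b a <ᵇ cwd b x) ≡ ((a <ᵇ x) ∧ (x <ᵇ b))
  cwd-beyond-rev a b x a<b b<N x<N rewrite ≤ᵇ-false a<b with ℕP.<-cmp x b
  ... | tri< x<b _ _ rewrite ≤ᵇ-false x<b | <ᵇ-true x<b =
    trans (<ᵇ-∸ (≤+N a (ℕP.<⇒≤ b<N)) (≤+N x (ℕP.<⇒≤ b<N)))
          (trans (<ᵇ-cong (ℕP.+-cancelʳ-< N a x) (ℕP.+-monoˡ-< N)) (sym (∧-identityʳ _)))
  ... | tri≈ _ refl _ rewrite ≤ᵇ-true (ℕP.≤-refl {x}) | <ᵇ-false {x} {x} ℕP.≤-refl
      | <ᵇ-false {(a + N) ∸ x} {x ∸ x} (ℕP.∸-monoˡ-≤ x (≤+N a (ℕP.<⇒≤ x<N))) = sym (∧-zeroʳ _)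
  ... | tri> _ _ b<x rewrite ≤ᵇ-true (ℕP.<⇒≤ b<x) | <ᵇ-false {x} {b} (ℕP.<⇒≤ b<x)
      | <ᵇ-false {(a + N) ∸ b} {x ∸ b} (ℕP.∸-monoˡ-≤ b (≤+N a (ℕP.<⇒≤ x<N))) = sym (∧-zeroʳ _)

  module Rotation (t : ℕ) (t<N : t < N) where

    private instance
      N≢0 : ℕ.NonZero N
      N≢0 = ℕ.>-nonZero (ℕP.≤-<-trans z≤n t<N)

    rotℕ : ℕ → ℕ
    rotℕ k = (t + k) % N

    rot : ℕ → Fin N
    rot k = F.fromℕ< (m%n<n (t + k) N)

    toℕ-rot : ∀ k → toℕ (rot k) ≡ rotℕ k
    toℕ-rot k = FP.toℕ-fromℕ< (m%n<n (t + k) N)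

    rotℕ-0 : rotℕ 0 ≡ t
    rotℕ-0 = trans (cong (_% N) (ℕP.+-identityʳ t)) (m<n⇒m%n≡m t<N)

    toℕ-rot-N : toℕ (rot N) ≡ t
    toℕ-rot-N = trans (toℕ-rot N) (trans ([m+n]%n≡m%n t N) (m<n⇒m%n≡m t<N))

    rotℕ-unwrapped : ∀ k → t + k < N → rotℕ k ≡ t + k
    rotℕ-unwrapped k = m<n⇒m%n≡m

    rotℕ-wrapped : ∀ k → k ≤ N → N ≤ t + k → rotℕ k ≡ (t + k) ∸ N
    rotℕ-wrapped k k≤N N≤t+k =
      trans (sym (m≤n⇒[n∸m]%m≡n%m N≤t+k))
            (m<n⇒m%n≡m (ℕP.+-cancelʳ-< N _ N (subst (_< N + N) (sym (ℕP.m∸n+n≡m N≤t+k)) (ℕP.+-mono-<-≤ t<N k≤N))))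

    cwd-sum : ∀ a b d → a + d ≡ b → cwd a b ≡ d
    cwd-sum a b d refl rewrite ≤ᵇ-true (ℕP.m≤m+n a d) = ℕP.m+n∸m≡n a d

    cwd-sum-wrapped : ∀ a b d → d < N → a + d ≡ b + N → cwd a b ≡ d
    cwd-sum-wrapped a b d d<N a+d≡b+N
      rewrite ≤ᵇ-false (ℕP.+-cancelʳ-< d b a (subst (b + d <_) (sym a+d≡b+N) (ℕP.+-monoʳ-< b d<N))) =
      trans (cong (_∸ a) (sym a+d≡b+N)) (ℕP.m+n∸m≡n a d)

    cwd-rotℕ : ∀ k → k < N → cwd t (rotℕ k) ≡ k
    cwd-rotℕ k k<N with (t + k) ℕP.<? N
    ... | yes t+k<N rewrite rotℕ-unwrapped k t+k<N = cwd-sum t (t + k) k refl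
    ... | no t+k≮N rewrite rotℕ-wrapped k (ℕP.<⇒≤ k<N) (ℕP.≮⇒≥ t+k≮N) =
      cwd-sum-wrapped t ((t + k) ∸ N) k k<N (sym (ℕP.m∸n+n≡m (ℕP.≮⇒≥ t+k≮N)))

    cwd<N : ∀ x → x < N → cwd t x < N
    cwd<N x x<N with t ≤ᵇ x in e
    ... | true = ℕP.≤-<-trans (ℕP.m∸n≤m x t) x<N
    ... | false = subst ((x + N) ∸ t <_) (ℕP.m+n∸m≡n t N)
                        (ℕP.∸-monoˡ-< (ℕP.+-monoˡ-< N x<t) (ℕP.≤-trans (ℕP.<⇒≤ t<N) (ℕP.m≤n+m N x)))
      where
      x<t : x < t
      x<t = ℕP.≰⇒> (λ t≤x → case trans (sym (≤ᵇ-true t≤x)) e of λ ())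
        where open Function using (case_of_)

    rotℕ-cwd : ∀ x → x < N → rotℕ (cwd t x) ≡ x
    rotℕ-cwd x x<N with t ≤ᵇ x in e
    ... | true = trans (cong (_% N) (ℕP.m+[n∸m]≡n {t} {x} (≤ᵇ-true⁻¹ e))) (m<n⇒m%n≡m x<N)
    ... | false = trans (cong (_% N) (ℕP.m+[n∸m]≡n (ℕP.≤-trans (ℕP.<⇒≤ t<N) (ℕP.m≤n+m N x))))
                        (trans ([m+n]%n≡m%n x N) (m<n⇒m%n≡m x<N))

    cwd-rot : ∀ k → k < N → cwd t (toℕ (rot k)) ≡ k
    cwd-rot k k<N = trans (cong (cwd t) (toℕ-rot k)) (cwd-rotℕ k k<N)

    rot-cwd : ∀ p → rot (cwd t (toℕ p)) ≡ p
    rot-cwd p = FP.toℕ-injective (trans (toℕ-rot _) (rotℕ-cwd (toℕ p) (FP.toℕ<n p)))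

    sum-rot : ∀ (f : Fin N → ℤ) → sum f ≡ sumTo N (f ∘ rot)
    sum-rot f = trans (sum-permute f (permutation (rot ∘ toℕ) unrot rot-unrot unrot-rot)) (sum≡sumTo N (f ∘ rot))
      where
      unrot : Fin N → Fin N
      unrot p = F.fromℕ< (cwd<N (toℕ p) (FP.toℕ<n p))
      rot-unrot : ∀ p → rot (toℕ (unrot p)) ≡ p
      rot-unrot p = trans (cong rot (FP.toℕ-fromℕ< (cwd<N (toℕ p) (FP.toℕ<n p)))) (rot-cwd p)
      unrot-rot : ∀ i → unrot (rot (toℕ i)) ≡ i
      unrot-rot i = FP.toℕ-injective (trans (FP.toℕ-fromℕ< (cwd<N _ (FP.toℕ<n _))) (cwd-rot (toℕ i) (FP.toℕ<n i)))

    even-cwd : even N ≡ true → ∀ x → x < N → even (cwd t x) ≡ not (even x xor even t)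
    even-cwd N-even x x<N = solve (even t) (even (cwd t x)) (trans (sym (even-+ t (cwd t x))) even-t+cwd)
      where
      solve : ∀ a d → not (a xor d) ≡ even x → d ≡ not (even x xor a)
      solve a d e rewrite sym e with a | d
      ... | true | true = refl
      ... | true | false = refl
      ... | false | true = refl
      ... | false | false = refl
      even-t+cwd : even (t + cwd t x) ≡ even x
      even-t+cwd with t ≤ᵇ x in e
      ... | true = cong even (ℕP.m+[n∸m]≡n {t} {x} (≤ᵇ-true⁻¹ e))
      ... | false = begin
        even (t + ((x + N) ∸ t))             ≡⟨ cong even (ℕP.m+[n∸m]≡n (ℕP.≤-trans (ℕP.<⇒≤ t<N) (ℕP.m≤n+m N x))) ⟩
        even (x + N)                         ≡⟨ even-+ x N ⟩
        not (even x xor even N)              ≡⟨ cong (λ b → not (even x xor b)) N-even ⟩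
        not (even x xor true)                ≡⟨ solve-true (even x) ⟩
        even x                               ∎
        where
        open ≡-Reasoning
        solve-true : ∀ b → not (b xor true) ≡ b
        solve-true true = refl
        solve-true false = refl

    private
      t+k+[j∸k] : ∀ {k j} → k < j → t + k + (j ∸ k) ≡ t + j
      t+k+[j∸k] {k} {j} k<j = trans (ℕP.+-assoc t k (j ∸ k)) (cong (t +_) (ℕP.m+[n∸m]≡n (ℕP.<⇒≤ k<j)))

    cwd-rotℕ-rotℕ : ∀ k j → k < j → j < N → cwd (rotℕ k) (rotℕ j) ≡ j ∸ k
    cwd-rotℕ-rotℕ k j k<j j<N with (t + j) ℕP.<? N | (t + k) ℕP.<? N
    ... | yes t+j<N | _ rewrite rotℕ-unwrapped j t+j<N | rotℕ-unwrapped k (ℕP.<-trans (ℕP.+-monoʳ-< t k<j) t+j<N) =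
      cwd-sum (t + k) (t + j) (j ∸ k) (t+k+[j∸k] k<j)
    ... | no t+j≮N | yes t+k<N rewrite rotℕ-unwrapped k t+k<N | rotℕ-wrapped j (ℕP.<⇒≤ j<N) (ℕP.≮⇒≥ t+j≮N) =
      cwd-sum-wrapped (t + k) ((t + j) ∸ N) (j ∸ k) (ℕP.≤-<-trans (ℕP.m∸n≤m j k) j<N)
                      (trans (t+k+[j∸k] k<j) (sym (ℕP.m∸n+n≡m (ℕP.≮⇒≥ t+j≮N))))
    ... | _ | no t+k≮N rewrite rotℕ-wrapped k (ℕP.<⇒≤ (ℕP.<-trans k<j j<N)) (ℕP.≮⇒≥ t+k≮N)
                             | rotℕ-wrapped j (ℕP.<⇒≤ j<N)
                                 (ℕP.≤-trans (ℕP.≮⇒≥ t+k≮N) (ℕP.+-monoʳ-≤ t (ℕP.<⇒≤ k<j))) =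
      cwd-sum ((t + k) ∸ N) ((t + j) ∸ N) (j ∸ k)
              (trans (sym (ℕP.+-∸-comm (j ∸ k) (ℕP.≮⇒≥ t+k≮N))) (cong (_∸ N) (t+k+[j∸k] k<j)))

    traversal : List (Fin N)
    traversal = keep (λ p → t <ᵇ toℕ p) (allFin N) ++ keep (λ p → toℕ p ≤ᵇ t) (allFin N)

    traversal≡ : traversal ≡ map rot (range 1 N)
    traversal≡ = map-injective FP.toℕ-injective (trans from-t (sym rotated))
      where
      A = N ∸ suc t
      1+t+A≡N : suc t + A ≡ N
      1+t+A≡N = ℕP.m+[n∸m]≡n t<N
      A+1+t≡N : A + suc t ≡ N
      A+1+t≡N = trans (ℕP.+-comm A (suc t)) 1+t+A≡N
      t+1+A≡N : t + suc A ≡ N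
      t+1+A≡N = trans (ℕP.+-suc t A) 1+t+A≡N
      split : range 0 N ≡ range 0 (suc t) ++ range (suc t) A
      split = trans (cong (range 0) (sym 1+t+A≡N)) (range-++ 0 (suc t) A)
      keep-after : keep (t <ᵇ_) (range 0 N) ≡ range (suc t) A
      keep-after = trans (cong (keep (t <ᵇ_)) split)
        (trans (keep-++ (t <ᵇ_) (range 0 (suc t)) (range (suc t) A))
               (cong₂ _++_ (keep-none 0 (suc t) (λ k _ k≤t → <ᵇ-false {t} {k} (ℕP.≤-pred k≤t)))
                           (keep-all (suc t) A (λ k t<k _ → <ᵇ-true t<k))))
      keep-upto : keep (_≤ᵇ t) (range 0 N) ≡ range 0 (suc t)
      keep-upto = trans (cong (keep (_≤ᵇ t)) split)
        (trans (keep-++ (_≤ᵇ t) (range 0 (suc t)) (range (suc t) A))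
               (trans (cong₂ _++_ (keep-all 0 (suc t) (λ k _ k≤t → ≤ᵇ-true (ℕP.≤-pred k≤t)))
                                  (keep-none (suc t) A (λ k t<k _ → ≤ᵇ-false t<k)))
                      (++-identityʳ (range 0 (suc t)))))
      from-t : map toℕ traversal ≡ range (suc t) A ++ range 0 (suc t)
      from-t = trans (map-++ toℕ (keep (λ p → t <ᵇ toℕ p) (allFin N)) (keep (λ p → toℕ p ≤ᵇ t) (allFin N)))
        (cong₂ _++_ (trans (sym (keep-map (t <ᵇ_) toℕ (allFin N))) (trans (cong (keep (t <ᵇ_)) (map-toℕ-allFin N)) keep-after))
                    (trans (sym (keep-map (_≤ᵇ t) toℕ (allFin N))) (trans (cong (keep (_≤ᵇ t)) (map-toℕ-allFin N)) keep-upto)))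
      before-wrap : map rotℕ (range 1 A) ≡ range (suc t) A
      before-wrap = trans (map-cong-range 1 A (λ k _ k<1+A → rotℕ-unwrapped k (subst (t + k <_) t+1+A≡N (ℕP.+-monoʳ-< t k<1+A))))
                          (trans (map-+-range t 1 A) (cong (λ z → range z A) (ℕP.+-comm t 1)))
      after-wrap : map rotℕ (range (suc A) (suc t)) ≡ range 0 (suc t)
      after-wrap = trans (map-cong-range (suc A) (suc t) wrapped) (map-∸-range (suc A) (suc t))
        where
        wrapped : ∀ k → suc A ≤ k → k < suc A + suc t → rotℕ k ≡ k ∸ suc A
        wrapped k 1+A≤k k<e = trans (rotℕ-wrapped k k≤N N≤t+k)
                                    (trans (cong ((t + k) ∸_) (sym t+1+A≡N)) (ℕP.[m+n]∸[m+o]≡n∸o t k (suc A)))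
          where
          N≤t+k = subst (_≤ t + k) t+1+A≡N (ℕP.+-monoʳ-≤ t 1+A≤k)
          k≤N = ℕP.≤-pred (subst (k <_) (trans (ℕP.+-suc (suc A) t) (cong suc (trans (ℕP.+-comm (suc A) t) t+1+A≡N))) k<e)
      rotated : map toℕ (map rot (range 1 N)) ≡ range (suc t) A ++ range 0 (suc t)
      rotated = begin
        map toℕ (map rot (range 1 N))                     ≡⟨ sym (map-∘ (range 1 N)) ⟩
        map (toℕ ∘ rot) (range 1 N)                       ≡⟨ map-cong toℕ-rot (range 1 N) ⟩
        map rotℕ (range 1 N)                              ≡⟨ cong (map rotℕ) (trans (cong (range 1) (sym A+1+t≡N)) (range-++ 1 A (suc t))) ⟩
        map rotℕ (range 1 A ++ range (suc A) (suc t))     ≡⟨ map-++ rotℕ (range 1 A) (range (suc A) (suc t)) ⟩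
        map rotℕ (range 1 A) ++ map rotℕ (range (suc A) (suc t)) ≡⟨ cong₂ _++_ before-wrap after-wrap ⟩
        range (suc t) A ++ range 0 (suc t)                ∎
        where open ≡-Reasoning

    keep-traversal : ∀ (Q : Fin N → Bool) c → 1 ≤ c → c ≤ N → (∀ k → 1 ≤ k → k ≤ N → Q (rot k) ≡ (k <ᵇ c)) →
      keep Q traversal ≡ map rot (range 1 (c ∸ 1))
    keep-traversal Q c 1≤c c≤N h = trans (cong (keep Q) traversal≡) (trans (keep-map Q rot (range 1 N))
      (cong (map rot) (trans (keep-cong-range 1 N (λ k 1≤k k<1+N → h k 1≤k (ℕP.≤-pred k<1+N)))
                             (keep-<ᵇ-range c 1 N 1≤c (ℕP.≤-trans c≤N (ℕP.n≤1+n N))))))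

module NonCrossingMatching (n : ℕ) (n-even : even n ≡ true)
  (m : Fin (2 * n) → Fin (2 * n)) (ncpm : IsNCPM n m) where

  open import Data.Nat as ℕ using (ℕ; zero; suc; _∸_; _≤_; _<_; _⊓_; _≤ᵇ_; _<ᵇ_; _≡ᵇ_; z≤n; s≤s; _*_)
  import Data.Nat.Properties as ℕP
  open import Data.Integer as ℤ using (ℤ; +_; -_)
  import Data.Integer.Properties as ℤP
  open import Data.Bool using (Bool; true; false; if_then_else_; _∧_; _∨_; not; _xor_)
  open import Data.Bool.Properties using (∧-zeroʳ; ∧-identityʳ; ∨-zeroʳ; not-involutive)
  open import Data.Fin as F using (Fin; toℕ)
  import Data.Fin.Properties as FP
  open import Data.List using (List; map; length; allFin; _++_)
  open import Data.List.Properties using (map-∘)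
  open import Data.Product using (_×_; _,_; proj₁; proj₂; Σ)
  open import Data.Sum using (_⊎_; inj₁; inj₂)
  open import Data.Empty using (⊥; ⊥-elim)
  open import Function using (_∘_)
  open import Relation.Binary using (tri<; tri≈; tri>)
  open import Relation.Binary.PropositionalEquality
  open import Data.Integer.Tactic.RingSolver using (solve-∀)
  open import Algebra.Properties.Semiring.Sum ℤP.+-*-semiring using (sum; sum-cong-≗; ∑-distrib-+; ∑-comm; *-distribˡ-sum)

  N : ℕ
  N = 2 * n

  N≡n+n : N ≡ n ℕ.+ n
  N≡n+n = cong (n ℕ.+_) (ℕP.+-identityʳ n)

  N-even : even N ≡ true
  N-even = trans (cong even (trans N≡n+n (sym (ℕP.+-identityʳ (n ℕ.+ n))))) (even-double+ n 0)

  open Clockwise N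

  pos : Fin N → ℕ
  pos = toℕ

  pos<N : ∀ x → pos x < N
  pos<N = FP.toℕ<n

  pos-injective : ∀ {a b} → pos a ≡ pos b → a ≡ b
  pos-injective = FP.toℕ-injective

  rep : Fin N → Bool
  rep = isRep n m

  m-involutive : ∀ x → m (m x) ≡ x
  m-involutive = proj₁ ncpm

  m-injective : ∀ {a b} → m a ≡ m b → a ≡ b
  m-injective {a} {b} e = trans (sym (m-involutive a)) (trans (cong m e) (m-involutive b))

  pos-m-m : ∀ x → pos (m (m x)) ≡ pos x
  pos-m-m x = cong pos (m-involutive x)

  pos-m≢pos : ∀ x → pos (m x) ≢ pos x
  pos-m≢pos x e = proj₁ (proj₂ ncpm) x (pos-injective e)

  no-crossing : ∀ a b → pos a < pos (m a) → pos b < pos (m b) →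
    pos a < pos b → pos b < pos (m a) → pos (m a) < pos (m b) → ⊥
  no-crossing a b a<ma b<mb a<b b<ma ma<mb = proj₂ (proj₂ ncpm) a b
    ( subst₂ _<_ (sym (ℕP.m≤n⇒m⊓n≡m (ℕP.<⇒≤ a<ma))) (sym (ℕP.m≤n⇒m⊓n≡m (ℕP.<⇒≤ b<mb))) a<b
    , subst₂ _<_ (sym (ℕP.m≤n⇒m⊓n≡m (ℕP.<⇒≤ b<mb))) (sym (ℕP.m≤n⇒m⊔n≡n (ℕP.<⇒≤ a<ma))) b<ma
    , subst₂ _<_ (sym (ℕP.m≤n⇒m⊔n≡n (ℕP.<⇒≤ a<ma))) (sym (ℕP.m≤n⇒m⊔n≡n (ℕP.<⇒≤ b<mb))) ma<mb )

  partner-between : ∀ y p → pos y < pos (m y) → pos y < pos p → pos p < pos (m y) →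
    (pos y < pos (m p)) × (pos (m p) < pos (m y))
  partner-between y p y<my y<p p<my with ℕP.<-cmp (pos (m p)) (pos y)
  ... | tri< mp<y _ _ = ⊥-elim (no-crossing (m p) y (subst (pos (m p) <_) (sym (pos-m-m p)) (ℕP.<-trans mp<y y<p))
                          y<my mp<y (subst (pos y <_) (sym (pos-m-m p)) y<p) (subst (_< pos (m y)) (sym (pos-m-m p)) p<my))
  ... | tri≈ _ mp≡y _ = ⊥-elim (ℕP.<-irrefl (cong pos (trans (sym (m-involutive p)) (cong m (pos-injective mp≡y)))) p<my)
  ... | tri> _ _ y<mp with ℕP.<-cmp (pos (m p)) (pos (m y))
  ...   | tri< mp<my _ _ = y<mp , mp<my
  ...   | tri≈ _ mp≡my _ = ⊥-elim (ℕP.<-irrefl (cong pos (sym (m-injective (pos-injective mp≡my)))) y<p)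
  ...   | tri> _ _ my<mp = ⊥-elim (no-crossing y p y<my (ℕP.<-trans p<my my<mp) y<p p<my my<mp)

  rep-m : ∀ p → rep (m p) ≡ not (rep p)
  rep-m p rewrite m-involutive p with ℕP.<-cmp (pos p) (pos (m p))
  ... | tri< p<mp _ _ = trans (<ᵇ-false (ℕP.<⇒≤ p<mp)) (cong not (sym (<ᵇ-true p<mp)))
  ... | tri≈ _ p≡mp _ = ⊥-elim (pos-m≢pos p (sym p≡mp))
  ... | tri> _ _ mp<p = trans (<ᵇ-true mp<p) (cong not (sym (<ᵇ-false (ℕP.<⇒≤ mp<p))))

  rep-false : ∀ x → rep x ≡ false → pos (m x) < pos (m (m x))
  rep-false x e = subst (pos (m x) <_) (sym (pos-m-m x)) (ℕP.≤∧≢⇒< (<ᵇ-false⁻¹ e) (pos-m≢pos x))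

  partner-invariant : (P : Fin N → Bool) → (∀ p → P p ≡ true → P (m p) ≡ true) → ∀ p → P (m p) ≡ P p
  partner-invariant P closed p with P p in e₁ | P (m p) in e₂
  ... | true | true = refl
  ... | false | false = refl
  ... | true | false = trans (sym e₂) (closed p e₁)
  ... | false | true = trans (sym (closed (m p) e₂)) (trans (cong P (m-involutive p)) e₁)

  sum-over-reps : (P : Fin N → Bool) → (∀ p → P (m p) ≡ P p) →
    sum (λ p → 𝟙 (P p)) ≡ sum (λ p → 𝟙 (P p ∧ rep p)) ℤ.+ sum (λ p → 𝟙 (P p ∧ rep p))
  sum-over-reps P invariant = begin
    sum (λ p → 𝟙 (P p))
      ≡⟨ sum-cong-≗ (λ p → 𝟙-split (P p) (rep p)) ⟩
    sum (λ p → 𝟙 (P p ∧ rep p) ℤ.+ 𝟙 (P p ∧ not (rep p)))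
      ≡⟨ ∑-distrib-+ (λ p → 𝟙 (P p ∧ rep p)) (λ p → 𝟙 (P p ∧ not (rep p))) ⟩
    sum (λ p → 𝟙 (P p ∧ rep p)) ℤ.+ sum (λ p → 𝟙 (P p ∧ not (rep p)))
      ≡⟨ cong (ℤ._+_ (sum (λ p → 𝟙 (P p ∧ rep p))))
              (trans (sum-cong-≗ (λ p → cong 𝟙 (cong₂ _∧_ (sym (invariant p)) (sym (rep-m p)))))
                     (sym (sum-involution (λ p → 𝟙 (P p ∧ rep p)) m m-involutive))) ⟩
    sum (λ p → 𝟙 (P p ∧ rep p)) ℤ.+ sum (λ p → 𝟙 (P p ∧ rep p)) ∎
    where
    open ≡-Reasoning
    𝟙-split : ∀ a b → 𝟙 a ≡ 𝟙 (a ∧ b) ℤ.+ 𝟙 (a ∧ not b)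
    𝟙-split false _ = refl
    𝟙-split true true = refl
    𝟙-split true false = refl

  count-below : ∀ c → c ≤ N → sum (λ p → 𝟙 (pos p <ᵇ c)) ≡ + c
  count-below c c≤N = trans (sum≡sumTo N (λ j → 𝟙 (j <ᵇ c))) (sumTo-<ᵇ N c c≤N)

  count-one : ∀ y → sum (λ q → 𝟙 (pos q ≡ᵇ pos y)) ≡ + 1
  count-one y = trans (sum-single _ y (λ q q≢y → cong 𝟙 (≡ᵇ-false (q≢y ∘ pos-injective)))) (cong 𝟙 (≡ᵇ-true {pos y} refl))

  count-all : sum {N} (λ q → + 1) ≡ + N
  count-all = trans (sum-cong-≗ (λ q → cong 𝟙 (sym (<ᵇ-true (pos<N q))))) (count-below N ℕP.≤-refl)

  between : ℕ → ℕ → Fin N → Bool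
  between a b p = (a <ᵇ pos p) ∧ (pos p <ᵇ b)

  count-between : ∀ a b → a < b → b ≤ N → sum (λ p → 𝟙 (between a b p)) ℤ.+ + suc a ≡ + b
  count-between a b a<b b≤N = begin
    sum (λ p → 𝟙 (between a b p)) ℤ.+ + suc a
      ≡⟨ cong (ℤ._+_ (sum (λ p → 𝟙 (between a b p)))) (sym (count-below (suc a) (ℕP.≤-trans a<b b≤N))) ⟩
    sum (λ p → 𝟙 (between a b p)) ℤ.+ sum (λ p → 𝟙 (pos p <ᵇ suc a))
      ≡⟨ sym (∑-distrib-+ (λ p → 𝟙 (between a b p)) (λ p → 𝟙 (pos p <ᵇ suc a))) ⟩
    sum (λ p → 𝟙 (between a b p) ℤ.+ 𝟙 (pos p <ᵇ suc a))
      ≡⟨ sum-cong-≗ (λ p → split (pos p)) ⟩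
    sum (λ p → 𝟙 (pos p <ᵇ b))
      ≡⟨ count-below b b≤N ⟩
    + b ∎
    where
    open ≡-Reasoning
    split : ∀ k → 𝟙 ((a <ᵇ k) ∧ (k <ᵇ b)) ℤ.+ 𝟙 (k <ᵇ suc a) ≡ 𝟙 (k <ᵇ b)
    split k with ℕP.<-cmp k (suc a)
    ... | tri< k≤a _ _ rewrite <ᵇ-false {a} {k} (ℕP.≤-pred k≤a) | <ᵇ-true k≤a | <ᵇ-true (ℕP.<-≤-trans k≤a a<b) = refl
    ... | tri≈ _ refl _ rewrite <ᵇ-true (ℕP.n<1+n a) | <ᵇ-false {suc a} {suc a} ℕP.≤-refl = ℤP.+-identityʳ (𝟙 (suc a <ᵇ b))
    ... | tri> _ _ a<k rewrite <ᵇ-true {a} {k} (ℕP.<-trans (ℕP.n<1+n a) a<k) | <ᵇ-false {k} {suc a} (ℕP.<⇒≤ a<k) =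
      ℤP.+-identityʳ (𝟙 (k <ᵇ b))

  inside : Fin N → Fin N → Bool
  inside y = between (pos y) (pos (m y))

  beyond : Fin N → Fin N → Bool
  beyond y p = (pos p <ᵇ pos y) ∨ (pos (m y) <ᵇ pos p)

  inside-m : ∀ y → pos y < pos (m y) → ∀ p → inside y (m p) ≡ inside y p
  inside-m y y<my = partner-invariant (inside y) λ p e →
    let (y<p , p<my) = partner-between y p y<my (<ᵇ-true⁻¹ (proj₁ (∧-true⁻¹ e))) (<ᵇ-true⁻¹ (proj₂ (∧-true⁻¹ e)))
    in cong₂ _∧_ (<ᵇ-true y<p) (<ᵇ-true p<my)

  beyond-false : ∀ y p → pos y ≤ pos p → pos p ≤ pos (m y) → beyond y p ≡ false
  beyond-false y p y≤p p≤my = cong₂ _∨_ (<ᵇ-false y≤p) (<ᵇ-false p≤my)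

  beyond-m : ∀ y → pos y < pos (m y) → ∀ p → beyond y (m p) ≡ beyond y p
  beyond-m y y<my = partner-invariant (beyond y) closed
    where
    contradiction : ∀ p → beyond y p ≡ true → pos y ≤ pos p → pos p ≤ pos (m y) → ⊥
    contradiction p e y≤p p≤my with trans (sym e) (beyond-false y p y≤p p≤my)
    ... | ()
    closed : ∀ p → beyond y p ≡ true → beyond y (m p) ≡ true
    closed p e with ℕP.<-cmp (pos (m p)) (pos y) | ℕP.<-cmp (pos (m p)) (pos (m y))
    ... | tri< mp<y _ _ | _ = cong (_∨ (pos (m y) <ᵇ pos (m p))) (<ᵇ-true mp<y)
    ... | _ | tri> _ _ my<mp = trans (cong ((pos (m p) <ᵇ pos y) ∨_) (<ᵇ-true my<mp)) (∨-zeroʳ _)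
    ... | tri≈ _ mp≡y _ | _ rewrite trans (sym (m-involutive p)) (cong m (pos-injective mp≡y)) =
      ⊥-elim (contradiction (m y) e (ℕP.<⇒≤ y<my) ℕP.≤-refl)
    ... | tri> _ _ _ | tri≈ _ mp≡my _ rewrite m-injective (pos-injective mp≡my) =
      ⊥-elim (contradiction y e ℕP.≤-refl (ℕP.<⇒≤ y<my))
    ... | tri> _ _ y<mp | tri< mp<my _ _ =
      let (y<p , p<my) = partner-between y (m p) y<my y<mp mp<my
      in ⊥-elim (contradiction p e (ℕP.<⇒≤ (subst (pos y <_) (pos-m-m p) y<p))
                                   (ℕP.<⇒≤ (subst (_< pos (m y)) (pos-m-m p) p<my)))

  count-around : ∀ y → pos y < pos (m y) → ∀ q →
    𝟙 (inside y q) ℤ.+ 𝟙 (beyond y q) ℤ.+ 𝟙 (pos q ≡ᵇ pos y) ℤ.+ 𝟙 (pos q ≡ᵇ pos (m y)) ≡ + 1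
  count-around y y<my q with ℕP.<-cmp (pos q) (pos y)
  ... | tri< q<y _ _ rewrite <ᵇ-false {pos y} {pos q} (ℕP.<⇒≤ q<y) | <ᵇ-true q<y | ≡ᵇ-false (ℕP.<⇒≢ q<y)
                           | ≡ᵇ-false (ℕP.<⇒≢ (ℕP.<-trans q<y y<my)) = refl
  ... | tri≈ _ q≡y _ rewrite q≡y | <ᵇ-false {pos y} {pos y} ℕP.≤-refl | <ᵇ-false {pos (m y)} {pos y} (ℕP.<⇒≤ y<my)
                           | ≡ᵇ-true {pos y} refl | ≡ᵇ-false (ℕP.<⇒≢ y<my) = refl
  ... | tri> _ _ y<q with ℕP.<-cmp (pos q) (pos (m y))
  ...   | tri< q<my _ _ rewrite <ᵇ-true y<q | <ᵇ-true q<my | <ᵇ-false {pos q} {pos y} (ℕP.<⇒≤ y<q)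
                              | <ᵇ-false {pos (m y)} {pos q} (ℕP.<⇒≤ q<my) | ≡ᵇ-false (ℕP.>⇒≢ y<q) | ≡ᵇ-false (ℕP.<⇒≢ q<my) = refl
  ...   | tri≈ _ q≡my _ rewrite q≡my | <ᵇ-true y<my | <ᵇ-false {pos (m y)} {pos (m y)} ℕP.≤-refl
                              | <ᵇ-false {pos (m y)} {pos y} (ℕP.<⇒≤ y<my) | ≡ᵇ-false (ℕP.>⇒≢ y<my) | ≡ᵇ-true {pos (m y)} refl = refl
  ...   | tri> _ _ my<q rewrite <ᵇ-true y<q | <ᵇ-false {pos q} {pos (m y)} (ℕP.<⇒≤ my<q) | <ᵇ-false {pos q} {pos y} (ℕP.<⇒≤ y<q)
                              | <ᵇ-true my<q | ≡ᵇ-false (ℕP.>⇒≢ y<q) | ≡ᵇ-false (ℕP.>⇒≢ my<q) = refl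

  -- The points strictly inside a chord are matched among themselves, so there is an even number of them.
  chord-span-odd : ∀ y → pos y < pos (m y) → Σ ℕ (λ j → pos (m y) ≡ j ℕ.+ j ℕ.+ suc (pos y))
  chord-span-odd y y<my with sum (λ p → 𝟙 (inside y p ∧ rep p)) | sum-nonneg (λ p → 𝟙 (inside y p ∧ rep p)) (𝟙-nonneg ∘ _)
                          | sum-over-reps (inside y) (inside-m y y<my)
  ... | + k | _ | halves = k , ℤP.+-injective (sym (begin
    + (k ℕ.+ k ℕ.+ suc (pos y))                                ≡⟨ ℤP.pos-+ (k ℕ.+ k) (suc (pos y)) ⟩
    + (k ℕ.+ k) ℤ.+ + suc (pos y)                              ≡⟨ cong (ℤ._+ + suc (pos y)) (trans (ℤP.pos-+ k k) (sym halves)) ⟩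
    sum (λ p → 𝟙 (inside y p)) ℤ.+ + suc (pos y)               ≡⟨ count-between (pos y) (pos (m y)) y<my (ℕP.<⇒≤ (pos<N (m y))) ⟩
    + pos (m y)                                                ∎))
    where open ≡-Reasoning

  even-partner : ∀ y → pos y < pos (m y) → even (pos (m y)) ≡ not (even (pos y))
  even-partner y y<my with chord-span-odd y y<my
  ... | j , e rewrite e | even-double+ j (suc (pos y)) = even-suc (pos y)

  signOf-partner-rep : ∀ y → pos y < pos (m y) → signOf (pos (m y)) ≡ - signOf (pos y)
  signOf-partner-rep y y<my rewrite even-partner y y<my = ±1-not (even (pos y))

  signOf-partner : ∀ x → signOf (pos (m x)) ≡ - signOf (pos x)
  signOf-partner x with ℕP.<-cmp (pos x) (pos (m x))
  ... | tri< x<mx _ _ = signOf-partner-rep x x<mx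
  ... | tri≈ _ x≡mx _ = ⊥-elim (pos-m≢pos x (sym x≡mx))
  ... | tri> _ _ mx<x = begin
    signOf (pos (m x))          ≡⟨ sym (ℤP.neg-involutive _) ⟩
    - - signOf (pos (m x))      ≡⟨ cong -_ (sym (signOf-partner-rep (m x) (subst (pos (m x) <_) (sym (pos-m-m x)) mx<x))) ⟩
    - signOf (pos (m (m x)))    ≡⟨ cong (-_ ∘ signOf) (pos-m-m x) ⟩
    - signOf (pos x)            ∎
    where open ≡-Reasoning

  -- Short and long edges

  span : Fin N → ℕ
  span y = pos (m y) ∸ pos y

  short : Fin N → Bool
  short y = span y <ᵇ n

  span-odd : ∀ y → pos y < pos (m y) → even (span y) ≡ false
  span-odd y y<my with chord-span-odd y y<my
  ... | j , e = trans (cong even span≡) (even-double+ j 1)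
    where
    span≡ : span y ≡ j ℕ.+ j ℕ.+ 1
    span≡ = trans (cong (_∸ pos y) e)
                  (trans (ℕP.+-∸-assoc (j ℕ.+ j) (ℕP.n≤1+n (pos y))) (cong (j ℕ.+ j ℕ.+_) (ℕP.m+n∸n≡m 1 (pos y))))

  span≢n : ∀ y → pos y < pos (m y) → span y ≢ n
  span≢n y y<my span≡n with trans (sym (span-odd y y<my)) (trans (cong even span≡n) n-even)
  ... | ()

  cwd-rep : ∀ y → pos y < pos (m y) → cwd (pos y) (pos (m y)) ≡ span y
  cwd-rep y y<my rewrite ≤ᵇ-true (ℕP.<⇒≤ y<my) = refl

  cwd-rep-back : ∀ y → pos y < pos (m y) → cwd (pos (m y)) (pos y) ≡ N ∸ span y
  cwd-rep-back y y<my rewrite ≤ᵇ-false y<my =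
    trans (cong ((pos y ℕ.+ N) ∸_) (sym (ℕP.m+[n∸m]≡n (ℕP.<⇒≤ y<my)))) (ℕP.[m+n]∸[m+o]≡n∸o (pos y) N (span y))

  short-back : ∀ y → pos y < pos (m y) → (cwd (pos (m y)) (pos y) <ᵇ n) ≡ not (short y)
  short-back y y<my = trans (cong (_<ᵇ n) (trans (cwd-rep-back y y<my) (cong (_∸ span y) N≡n+n)))
    (<ᵇ-complement n (span y) (span≢n y y<my)
      (subst (span y ≤_) N≡n+n (ℕP.≤-trans (ℕP.m∸n≤m (pos (m y)) (pos y)) (ℕP.<⇒≤ (pos<N (m y))))))

  tailE-rep : ∀ y → pos y < pos (m y) → tailE n m y ≡ (if short y then y else m y)
  tailE-rep y y<my rewrite ≤ᵇ-true (ℕP.<⇒≤ y<my) = refl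

  tailE-m-rep : ∀ y → pos y < pos (m y) → tailE n m (m y) ≡ tailE n m y
  tailE-m-rep y y<my rewrite m-involutive y | short-back y y<my | tailE-rep y y<my with short y
  ... | true = refl
  ... | false = refl

  hiddenFrom : Fin N → Fin N → Bool
  hiddenFrom T p = (0 <ᵇ cwd (pos T) (pos p)) ∧ (cwd (pos T) (pos p) <ᵇ cwd (pos T) (pos (m T)))

  outsideFrom : Fin N → Fin N → Bool
  outsideFrom T p = cwd (pos T) (pos (m T)) <ᵇ cwd (pos T) (pos p)

  hidden-rep : ∀ y → pos y < pos (m y) → ∀ p → hidden n m y p ≡ (if short y then inside y p else beyond y p)
  hidden-rep y y<my p = trans (cong (λ T → hiddenFrom T p) (tailE-rep y y<my)) (by-length (short y))
    where
    by-length : ∀ s → hiddenFrom (if s then y else m y) p ≡ (if s then inside y p else beyond y p)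
    by-length true = cwd-between (pos y) (pos (m y)) (pos p) y<my (ℕP.<⇒≤ (pos<N (m y)))
    by-length false = trans (cong (λ z → (0 <ᵇ cwd (pos (m y)) (pos p)) ∧ (cwd (pos (m y)) (pos p) <ᵇ cwd (pos (m y)) z)) (pos-m-m y))
                            (cwd-between-rev (pos y) (pos (m y)) (pos p) y<my (pos<N (m y)) (pos<N p))

  outside-rep : ∀ y → pos y < pos (m y) → ∀ p → outside n m y p ≡ (if short y then beyond y p else inside y p)
  outside-rep y y<my p = trans (cong (λ T → outsideFrom T p) (tailE-rep y y<my)) (by-length (short y))
    where
    by-length : ∀ s → outsideFrom (if s then y else m y) p ≡ (if s then beyond y p else inside y p)
    by-length true = cwd-beyond (pos y) (pos (m y)) (pos p) y<my (pos<N (m y)) (pos<N p)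
    by-length false = trans (cong (λ z → cwd (pos (m y)) z <ᵇ cwd (pos (m y)) (pos p)) (pos-m-m y))
                            (cwd-beyond-rev (pos y) (pos (m y)) (pos p) y<my (pos<N (m y)) (pos<N p))

  hidden-m : ∀ y → pos y < pos (m y) → ∀ p → hidden n m y (m p) ≡ hidden n m y p
  hidden-m y y<my p = trans (hidden-rep y y<my (m p))
    (trans (if-cong (short y) (inside-m y y<my p) (beyond-m y y<my p)) (sym (hidden-rep y y<my p)))

  outside-m : ∀ y → pos y < pos (m y) → ∀ p → outside n m y (m p) ≡ outside n m y p
  outside-m y y<my p = trans (outside-rep y y<my (m p))
    (trans (if-cong (short y) (beyond-m y y<my p) (inside-m y y<my p)) (sym (outside-rep y y<my p)))

  leftEnd : Fin N → Fin N
  leftEnd x = if rep x then x else m x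

  leftEnd-rep : ∀ x → pos (leftEnd x) < pos (m (leftEnd x))
  leftEnd-rep x with rep x in e
  ... | true = <ᵇ-true⁻¹ e
  ... | false = rep-false x e

  leftEnd-cases : ∀ x → (leftEnd x ≡ x) ⊎ (leftEnd x ≡ m x)
  leftEnd-cases x with rep x
  ... | true = inj₁ refl
  ... | false = inj₂ refl

  tailE-m : ∀ p → tailE n m (m p) ≡ tailE n m p
  tailE-m p with rep p in e
  ... | true = tailE-m-rep p (<ᵇ-true⁻¹ e)
  ... | false = sym (trans (cong (tailE n m) (sym (m-involutive p))) (tailE-m-rep (m p) (rep-false p e)))

  tailE-leftEnd : ∀ x → tailE n m x ≡ tailE n m (leftEnd x)
  tailE-leftEnd x with rep x
  ... | true = refl
  ... | false = sym (tailE-m x)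

  -- Lengths of edges

  countEdges≡sum : ∀ P → + countEdges n m P ≡ sum (λ z → 𝟙 (rep z ∧ P z ∧ P (m z)))
  countEdges≡sum P = length-keep (λ z → rep z ∧ P z ∧ P (m z)) (λ z → z)

  countEdges-invariant : ∀ P → (∀ z → P (m z) ≡ P z) → + countEdges n m P ≡ sum (λ z → 𝟙 (P z ∧ rep z))
  countEdges-invariant P invariant = trans (countEdges≡sum P)
    (sum-cong-≗ λ z → cong 𝟙 (trans (cong (λ b → rep z ∧ P z ∧ b) (invariant z)) (swap (rep z) (P z))))
    where
    swap : ∀ r p → r ∧ p ∧ p ≡ p ∧ r
    swap true true = refl
    swap true false = refl
    swap false true = refl
    swap false false = refl

  count-points≡2*countEdges : ∀ P → (∀ z → P (m z) ≡ P z) →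
    sum (λ z → 𝟙 (P z)) ≡ + (countEdges n m P ℕ.+ countEdges n m P)
  count-points≡2*countEdges P invariant =
    trans (sum-over-reps P invariant)
          (trans (cong₂ ℤ._+_ (sym (countEdges-invariant P invariant)) (sym (countEdges-invariant P invariant)))
                 (sym (ℤP.pos-+ (countEdges n m P) (countEdges n m P))))

  -- The hidden side of an edge is the side with fewer points.
  module HiddenSide (y : Fin N) (y<my : pos y < pos (m y)) where

    private
      #inside #beyond : ℕ
      #inside = length (keep (inside y) (allFin N))
      #beyond = length (keep (beyond y) (allFin N))

      sum-inside : sum (λ z → 𝟙 (inside y z)) ≡ + #inside
      sum-inside = sym (length-keep (inside y) (λ z → z))

      sum-beyond : sum (λ z → 𝟙 (beyond y z)) ≡ + #beyond
      sum-beyond = sym (length-keep (beyond y) (λ z → z))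

      #inside+a+1≡b : #inside ℕ.+ suc (pos y) ≡ pos (m y)
      #inside+a+1≡b = ℤP.+-injective (trans (ℤP.pos-+ #inside (suc (pos y)))
        (trans (cong (ℤ._+ + suc (pos y)) (sym sum-inside)) (count-between (pos y) (pos (m y)) y<my (ℕP.<⇒≤ (pos<N (m y))))))

      span≡ : span y ≡ suc #inside
      span≡ = trans (cong (_∸ pos y) (trans (sym #inside+a+1≡b) (ℕP.+-suc #inside (pos y)))) (ℕP.m+n∸n≡m (suc #inside) (pos y))

      all-points : #inside ℕ.+ #beyond ℕ.+ 2 ≡ n ℕ.+ n
      all-points = trans (ℤP.+-injective (begin
        + (#inside ℕ.+ #beyond ℕ.+ 2)
          ≡⟨ trans (ℤP.pos-+ (#inside ℕ.+ #beyond) 2) (cong (ℤ._+ + 2) (ℤP.pos-+ #inside #beyond)) ⟩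
        + #inside ℤ.+ + #beyond ℤ.+ + 2
          ≡⟨ cong₂ (λ u w → u ℤ.+ w ℤ.+ + 2) (sym sum-inside) (sym sum-beyond) ⟩
        sum (λ q → 𝟙 (inside y q)) ℤ.+ sum (λ q → 𝟙 (beyond y q)) ℤ.+ (+ 1 ℤ.+ + 1)
          ≡⟨ cong₂ (λ u w → sum (λ q → 𝟙 (inside y q)) ℤ.+ sum (λ q → 𝟙 (beyond y q)) ℤ.+ (u ℤ.+ w))
                   (sym (count-one y)) (sym (count-one (m y))) ⟩
        sum (λ q → 𝟙 (inside y q)) ℤ.+ sum (λ q → 𝟙 (beyond y q))
          ℤ.+ (sum (λ q → 𝟙 (pos q ≡ᵇ pos y)) ℤ.+ sum (λ q → 𝟙 (pos q ≡ᵇ pos (m y))))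
          ≡⟨ sym (cong₂ ℤ._+_ (∑-distrib-+ (λ q → 𝟙 (inside y q)) _) (∑-distrib-+ (λ q → 𝟙 (pos q ≡ᵇ pos y)) _)) ⟩
        sum (λ q → 𝟙 (inside y q) ℤ.+ 𝟙 (beyond y q)) ℤ.+ sum (λ q → 𝟙 (pos q ≡ᵇ pos y) ℤ.+ 𝟙 (pos q ≡ᵇ pos (m y)))
          ≡⟨ sym (∑-distrib-+ (λ q → 𝟙 (inside y q) ℤ.+ 𝟙 (beyond y q)) _) ⟩
        sum (λ q → 𝟙 (inside y q) ℤ.+ 𝟙 (beyond y q) ℤ.+ (𝟙 (pos q ≡ᵇ pos y) ℤ.+ 𝟙 (pos q ≡ᵇ pos (m y))))
          ≡⟨ sum-cong-≗ (λ q → trans (sym (ℤP.+-assoc (𝟙 (inside y q) ℤ.+ 𝟙 (beyond y q)) (𝟙 (pos q ≡ᵇ pos y)) _))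
                                     (count-around y y<my q)) ⟩
        sum {N} (λ q → + 1)
          ≡⟨ count-all ⟩
        + N ∎)) N≡n+n
        where open ≡-Reasoning

      #hidden #outside : ℕ
      #hidden = countEdges n m (hidden n m y)
      #outside = countEdges n m (outside n m y)

      hidden-points : + (#hidden ℕ.+ #hidden) ≡ (if short y then + #inside else + #beyond)
      hidden-points = trans (sym (count-points≡2*countEdges (hidden n m y) (hidden-m y y<my)))
        (trans (sum-cong-≗ (λ z → cong 𝟙 (hidden-rep y y<my z))) (by-length (short y)))
        where
        by-length : ∀ s → sum (λ z → 𝟙 (if s then inside y z else beyond y z)) ≡ (if s then + #inside else + #beyond)
        by-length true = sum-inside
        by-length false = sum-beyond

      outside-points : + (#outside ℕ.+ #outside) ≡ (if short y then + #beyond else + #inside)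
      outside-points = trans (sym (count-points≡2*countEdges (outside n m y) (outside-m y y<my)))
        (trans (sum-cong-≗ (λ z → cong 𝟙 (outside-rep y y<my z))) (by-length (short y)))
        where
        by-length : ∀ s → sum (λ z → 𝟙 (if s then beyond y z else inside y z)) ≡ (if s then + #beyond else + #inside)
        by-length true = sum-beyond
        by-length false = sum-inside

    hidden≤outside : #hidden ≤ #outside
    hidden≤outside with short y in s | hidden-points | outside-points
    ... | true | h | o = m+m≤n+n⇒m≤n _ _ (subst₂ _≤_ (sym (ℤP.+-injective h)) (sym (ℤP.+-injective o))
                           (short-side-≤ #inside #beyond n all-points (subst (_< n) span≡ (<ᵇ-true⁻¹ s))))
    ... | false | h | o = m+m≤n+n⇒m≤n _ _ (subst₂ _≤_ (sym (ℤP.+-injective h)) (sym (ℤP.+-injective o))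
                           (long-side-≥ #inside #beyond n all-points
                             (subst (n <_) span≡ (ℕP.≤∧≢⇒< (<ᵇ-false⁻¹ s) (span≢n y y<my ∘ sym)))))

  len-rep : ∀ y → pos y < pos (m y) → + len n m y ≡ sum (λ z → 𝟙 (hidden n m y z ∧ rep z))
  len-rep y y<my = trans (cong +_ (ℕP.m≤n⇒m⊓n≡m (HiddenSide.hidden≤outside y y<my)))
                         (countEdges-invariant (hidden n m y) (hidden-m y y<my))

  -- The cover of a point

  straddle : ℕ → ℤ
  straddle k = sum (λ q → ifz ((pos q <ᵇ k) ∧ (k ≤ᵇ pos (m q))) (signOf (pos q)))

  module StraddleStep (k : ℕ) (k<N : k < N) where

    private
      pk : Fin N
      pk = F.fromℕ< k<N

      pos-pk : pos pk ≡ k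
      pos-pk = FP.toℕ-fromℕ< k<N

    opening closing : ℤ
    opening = ifz (k <ᵇ pos (m pk)) (signOf k)
    closing = ifz (pos (m pk) <ᵇ k) (signOf k)

    sum-opening : sum (λ q → ifz ((pos q ≡ᵇ k) ∧ (k <ᵇ pos (m q))) (signOf (pos q))) ≡ opening
    sum-opening = trans (sum-single _ pk others) at-pk
      where
      others : ∀ q → q ≢ pk → ifz ((pos q ≡ᵇ k) ∧ (k <ᵇ pos (m q))) (signOf (pos q)) ≡ + 0
      others q q≢pk = cong (λ c → ifz (c ∧ (k <ᵇ pos (m q))) (signOf (pos q)))
                           (≡ᵇ-false (λ e → q≢pk (pos-injective (trans e (sym pos-pk)))))
      at-pk : ifz ((pos pk ≡ᵇ k) ∧ (k <ᵇ pos (m pk))) (signOf (pos pk)) ≡ opening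
      at-pk rewrite pos-pk | ≡ᵇ-true {k} refl = refl

    -- The chord closing at k starts at the partner of pk, whose sign is −signOf k.
    sum-closing : sum (λ q → ifz ((pos q <ᵇ k) ∧ (pos (m q) ≡ᵇ k)) (signOf (pos q))) ≡ - closing
    sum-closing = trans (sum-single _ (m pk) others) at-mpk
      where
      others : ∀ q → q ≢ m pk → ifz ((pos q <ᵇ k) ∧ (pos (m q) ≡ᵇ k)) (signOf (pos q)) ≡ + 0
      others q q≢mpk = trans (cong (λ c → ifz ((pos q <ᵇ k) ∧ c) (signOf (pos q)))
        (≡ᵇ-false (λ e → q≢mpk (trans (sym (m-involutive q)) (cong m (pos-injective (trans e (sym pos-pk))))))))
        (ifz-∧false (pos q <ᵇ k) _)
      at-mpk : ifz ((pos (m pk) <ᵇ k) ∧ (pos (m (m pk)) ≡ᵇ k)) (signOf (pos (m pk))) ≡ - closing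
      at-mpk rewrite pos-m-m pk | pos-pk | ≡ᵇ-true {k} refl | signOf-partner pk | pos-pk =
        trans (cong (λ c → ifz c (- signOf k)) (∧-identityʳ _)) (ifz-neg _ (signOf k))

    opening+closing : opening ℤ.+ closing ≡ signOf k
    opening+closing with ℕP.<-cmp k (pos (m pk))
    ... | tri< k<mpk _ _ rewrite <ᵇ-true k<mpk | <ᵇ-false {pos (m pk)} {k} (ℕP.<⇒≤ k<mpk) = ℤP.+-identityʳ (signOf k)
    ... | tri≈ _ k≡mpk _ = ⊥-elim (pos-m≢pos pk (trans (sym k≡mpk) (sym pos-pk)))
    ... | tri> _ _ mpk<k rewrite <ᵇ-true mpk<k | <ᵇ-false {k} {pos (m pk)} (ℕP.<⇒≤ mpk<k) = ℤP.+-identityˡ (signOf k)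

    straddle-suc-closing : straddle (suc k) ℤ.+ - closing ≡ straddle k ℤ.+ opening
    straddle-suc-closing = begin
      straddle (suc k) ℤ.+ - closing
        ≡⟨ cong (ℤ._+_ (straddle (suc k))) (sym sum-closing) ⟩
      straddle (suc k) ℤ.+ sum (λ q → ifz ((pos q <ᵇ k) ∧ (pos (m q) ≡ᵇ k)) (signOf (pos q)))
        ≡⟨ sym (∑-distrib-+ {N} _ _) ⟩
      sum (λ q → ifz ((pos q <ᵇ suc k) ∧ (suc k ≤ᵇ pos (m q))) (signOf (pos q))
                 ℤ.+ ifz ((pos q <ᵇ k) ∧ (pos (m q) ≡ᵇ k)) (signOf (pos q)))
        ≡⟨ sum-cong-≗ (λ q → straddle-step (pos q) (pos (m q)) k (signOf (pos q))) ⟩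
      sum (λ q → ifz ((pos q <ᵇ k) ∧ (k ≤ᵇ pos (m q))) (signOf (pos q))
                 ℤ.+ ifz ((pos q ≡ᵇ k) ∧ (k <ᵇ pos (m q))) (signOf (pos q)))
        ≡⟨ ∑-distrib-+ {N} _ _ ⟩
      straddle k ℤ.+ sum (λ q → ifz ((pos q ≡ᵇ k) ∧ (k <ᵇ pos (m q))) (signOf (pos q)))
        ≡⟨ cong (ℤ._+_ (straddle k)) sum-opening ⟩
      straddle k ℤ.+ opening ∎
      where open ≡-Reasoning

  straddle-suc : ∀ k → k < N → straddle (suc k) ≡ straddle k ℤ.+ signOf k
  straddle-suc k k<N = begin
    straddle (suc k)                                  ≡⟨ x≡x-b+b (straddle (suc k)) closing ⟩
    (straddle (suc k) ℤ.+ - closing) ℤ.+ closing      ≡⟨ cong (ℤ._+ closing) straddle-suc-closing ⟩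
    (straddle k ℤ.+ opening) ℤ.+ closing              ≡⟨ ℤP.+-assoc (straddle k) opening closing ⟩
    straddle k ℤ.+ (opening ℤ.+ closing)              ≡⟨ cong (ℤ._+_ (straddle k)) opening+closing ⟩
    straddle k ℤ.+ signOf k                           ∎
    where
    open ≡-Reasoning
    open StraddleStep k k<N
    x≡x-b+b : ∀ x b → x ≡ (x ℤ.+ - b) ℤ.+ b
    x≡x-b+b = solve-∀

  straddle≡ : ∀ k → k ≤ N → straddle k ≡ 𝟙 (not (even k))
  straddle≡ zero _ = sum-zero {N} _ (λ _ → refl)
  straddle≡ (suc k) k<N = trans (straddle-suc k k<N) (trans (cong (ℤ._+ signOf k) (straddle≡ k (ℕP.<⇒≤ k<N))) (odd-suc k))
    where
    odd-suc : ∀ k → 𝟙 (not (even k)) ℤ.+ signOf k ≡ 𝟙 (not (even (suc k)))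
    odd-suc k rewrite even-suc k with even k
    ... | true = refl
    ... | false = refl

  sgn-rep : ∀ y → pos y < pos (m y) → sgn n m y ≡ (if short y then signOf (pos y) else - signOf (pos y))
  sgn-rep y y<my = trans (cong (signOf ∘ pos) (tailE-rep y y<my)) (by-length (short y))
    where
    by-length : ∀ s → signOf (pos (if s then y else m y)) ≡ (if s then signOf (pos y) else - signOf (pos y))
    by-length true = refl
    by-length false = signOf-partner-rep y y<my

  endpoint : Fin N → Fin N → Bool
  endpoint y g = (pos g ≡ᵇ pos y) ∨ (pos g ≡ᵇ pos (m y))

  cover : Fin N → ℤ
  cover g = sum (λ y → ifz (rep y ∧ hidden n m y g) (sgn n m y))

  longCorrection : ℤ
  longCorrection = sum (λ y → ifz (rep y ∧ not (short y)) (signOf (pos y)))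

  𝟙-negative : Fin N → ℤ
  𝟙-negative g = 𝟙 (not (even (pos (tailE n m g))))

  -- A long edge hides the complement of its chord interval; adding signOf of its left end
  -- turns its contribution into that of the interval, up to the two endpoints.
  cover-term : ∀ y g →
    ifz (rep y ∧ hidden n m y g) (sgn n m y) ℤ.+ ifz (rep y ∧ not (short y)) (signOf (pos y))
      ≡ ifz (rep y ∧ inside y g) (signOf (pos y)) ℤ.+ ifz (rep y ∧ not (short y) ∧ endpoint y g) (signOf (pos y))
  cover-term y g with rep y in e
  ... | false = refl
  ... | true = trans (cong₂ (λ h s → ifz h s ℤ.+ ifz (not (short y)) (signOf (pos y))) (hidden-rep y y<my g) (sgn-rep y y<my))
                     (by-length (short y))
    where
    y<my : pos y < pos (m y)
    y<my = <ᵇ-true⁻¹ e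
    by-length : ∀ s → ifz (if s then inside y g else beyond y g) (if s then signOf (pos y) else - signOf (pos y))
                        ℤ.+ ifz (not s) (signOf (pos y))
                      ≡ ifz (inside y g) (signOf (pos y)) ℤ.+ ifz (not s ∧ endpoint y g) (signOf (pos y))
    by-length true = refl
    by-length false = one-of-four (inside y g) (beyond y g) (pos g ≡ᵇ pos y) (pos g ≡ᵇ pos (m y)) (signOf (pos y))
                                  (count-around y y<my g)

  sum-inside≡straddle : ∀ g → pos g < pos (m g) →
    sum (λ y → ifz (rep y ∧ inside y g) (signOf (pos y))) ≡ straddle (pos g)
  sum-inside≡straddle g g<mg = sum-cong-≗ term
    where
    term : ∀ y → ifz (rep y ∧ inside y g) (signOf (pos y)) ≡ ifz ((pos y <ᵇ pos g) ∧ (pos g ≤ᵇ pos (m y))) (signOf (pos y))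
    term y with ℕP.<-cmp (pos y) (pos g)
    ... | tri≈ _ y≡g _ rewrite y≡g | <ᵇ-false {pos g} {pos g} ℕP.≤-refl = ifz-∧false (pos g <ᵇ pos (m y)) _
    ... | tri> _ _ g<y rewrite <ᵇ-false {pos y} {pos g} (ℕP.<⇒≤ g<y) = ifz-∧false (rep y) _
    ... | tri< y<g _ _ rewrite <ᵇ-true y<g with ℕP.<-cmp (pos g) (pos (m y))
    ...   | tri< g<my _ _ rewrite <ᵇ-true g<my | ≤ᵇ-true (ℕP.<⇒≤ g<my) | <ᵇ-true (ℕP.<-trans y<g g<my) = refl
    ...   | tri≈ _ g≡my _ = ⊥-elim (ℕP.<-asym y<g (subst (pos g <_) (cong pos (sym (trans (sym (m-involutive y))
                                                                       (cong m (sym (pos-injective g≡my)))))) g<mg))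
    ...   | tri> _ _ my<g rewrite <ᵇ-false {pos g} {pos (m y)} (ℕP.<⇒≤ my<g) | ≤ᵇ-false {pos g} {pos (m y)} my<g =
      ifz-∧false (rep y) _

  sum-endpoint : ∀ g → pos g < pos (m g) →
    sum (λ y → ifz (rep y ∧ not (short y) ∧ endpoint y g) (signOf (pos y))) ≡ ifz (not (short g)) (signOf (pos g))
  sum-endpoint g g<mg = trans (sum-single _ g others) at-g
    where
    y≡mg : ∀ y → pos g ≡ pos (m y) → y ≡ m g
    y≡mg y e′ = trans (sym (m-involutive y)) (cong m (pos-injective (sym e′)))
    others : ∀ y → y ≢ g → ifz (rep y ∧ not (short y) ∧ endpoint y g) (signOf (pos y)) ≡ + 0
    others y y≢g with rep y in e
    ... | false = refl
    ... | true rewrite ≡ᵇ-false {pos g} {pos y} (λ e′ → y≢g (pos-injective (sym e′)))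
                     | ≡ᵇ-false {pos g} {pos (m y)}
                         (λ e′ → ℕP.<-asym g<mg (subst₂ _<_ (cong pos (y≡mg y e′)) (trans (cong (pos ∘ m) (y≡mg y e′)) (pos-m-m g))
                                                        (<ᵇ-true⁻¹ e)))
      = ifz-∧false (not (short y)) _
    at-g : ifz (rep g ∧ not (short g) ∧ endpoint g g) (signOf (pos g)) ≡ ifz (not (short g)) (signOf (pos g))
    at-g rewrite <ᵇ-true g<mg | ≡ᵇ-true {pos g} refl = cong (λ c → ifz c (signOf (pos g))) (∧-identityʳ (not (short g)))

  𝟙-negative-rep : ∀ g → pos g < pos (m g) → 𝟙-negative g ≡ 𝟙 (not (even (pos g))) ℤ.+ ifz (not (short g)) (signOf (pos g))
  𝟙-negative-rep g g<mg = trans (cong (λ T → 𝟙 (not (even (pos T)))) (tailE-rep g g<mg)) (by-length (short g))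
    where
    by-length : ∀ s → 𝟙 (not (even (pos (if s then g else m g)))) ≡ 𝟙 (not (even (pos g))) ℤ.+ ifz (not s) (signOf (pos g))
    by-length true = sym (ℤP.+-identityʳ _)
    by-length false rewrite even-partner g g<mg with even (pos g)
    ... | true = refl
    ... | false = refl

  cover+longCorrection : ∀ g → pos g < pos (m g) → cover g ℤ.+ longCorrection ≡ 𝟙-negative g
  cover+longCorrection g g<mg = begin
    cover g ℤ.+ longCorrection
      ≡⟨ sym (∑-distrib-+ {N} _ _) ⟩
    sum (λ y → ifz (rep y ∧ hidden n m y g) (sgn n m y) ℤ.+ ifz (rep y ∧ not (short y)) (signOf (pos y)))
      ≡⟨ sum-cong-≗ (λ y → cover-term y g) ⟩
    sum (λ y → ifz (rep y ∧ inside y g) (signOf (pos y)) ℤ.+ ifz (rep y ∧ not (short y) ∧ endpoint y g) (signOf (pos y)))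
      ≡⟨ ∑-distrib-+ {N} _ _ ⟩
    sum (λ y → ifz (rep y ∧ inside y g) (signOf (pos y))) ℤ.+ sum (λ y → ifz (rep y ∧ not (short y) ∧ endpoint y g) (signOf (pos y)))
      ≡⟨ cong₂ ℤ._+_ (trans (sum-inside≡straddle g g<mg) (straddle≡ (pos g) (ℕP.<⇒≤ (pos<N g)))) (sum-endpoint g g<mg) ⟩
    𝟙 (not (even (pos g))) ℤ.+ ifz (not (short g)) (signOf (pos g))
      ≡⟨ sym (𝟙-negative-rep g g<mg) ⟩
    𝟙-negative g ∎
    where open ≡-Reasoning

  signedLen-as-sum : ∀ y c → (c ≡ true → rep y ≡ true) →
    ifz c (signedLen n m y) ≡ sum (λ g → ifz (rep g) (ifz (c ∧ hidden n m y g) (sgn n m y)))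
  signedLen-as-sum y false _ = sym (sum-zero {N} _ (λ g → zero-if (rep g)))
    where
    zero-if : ∀ b → ifz b (+ 0) ≡ + 0
    zero-if true = refl
    zero-if false = refl
  signedLen-as-sum y true rep-y =
    trans (cong (sgn n m y ℤ.*_) (len-rep y (<ᵇ-true⁻¹ (rep-y refl))))
          (trans (*-distribˡ-sum (sgn n m y) (λ g → 𝟙 (hidden n m y g ∧ rep g))) (sum-cong-≗ λ g → term (hidden n m y g) (rep g)))
    where
    term : ∀ h b → sgn n m y ℤ.* 𝟙 (h ∧ b) ≡ ifz b (ifz h (sgn n m y))
    term true true = ℤP.*-identityʳ (sgn n m y)
    term true false = ℤP.*-zeroʳ (sgn n m y)
    term false true = ℤP.*-zeroʳ (sgn n m y)
    term false false = ℤP.*-zeroʳ (sgn n m y)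

  -- Double counting: each edge contributes its sign once for every edge hidden behind it.
  weight≡sum-cover : weight n m ≡ sum (λ g → ifz (rep g) (cover g))
  weight≡sum-cover = begin
    weight n m
      ≡⟨ sumℤ-keep rep (signedLen n m) (λ z → z) ⟩
    sum (λ y → ifz (rep y) (signedLen n m y))
      ≡⟨ sum-cong-≗ (λ y → signedLen-as-sum y (rep y) (λ e → e)) ⟩
    sum (λ y → sum (λ g → ifz (rep g) (ifz (rep y ∧ hidden n m y g) (sgn n m y))))
      ≡⟨ ∑-comm (λ y g → ifz (rep g) (ifz (rep y ∧ hidden n m y g) (sgn n m y))) ⟩
    sum (λ g → sum (λ y → ifz (rep g) (ifz (rep y ∧ hidden n m y g) (sgn n m y))))
      ≡⟨ sum-cong-≗ (λ g → sum-ifz (rep g) (λ y → ifz (rep y ∧ hidden n m y g) (sgn n m y))) ⟩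
    sum (λ g → ifz (rep g) (cover g)) ∎
    where open ≡-Reasoning

  -- Nesting of edges

  data Behind (y p : Fin N) : Set where
    short-inside : span y < n → pos y < pos p → pos p < pos (m y) → Behind y p
    long-beyond : n < span y → (pos p < pos y) ⊎ (pos (m y) < pos p) → Behind y p

  behind : ∀ y p → pos y < pos (m y) → hidden n m y p ≡ true → Behind y p
  behind y p y<my h with short y in s | hidden-rep y y<my p
  ... | true | e = let (y<p , p<my) = ∧-true⁻¹ (trans (sym e) h) in
    short-inside (<ᵇ-true⁻¹ s) (<ᵇ-true⁻¹ y<p) (<ᵇ-true⁻¹ p<my)
  ... | false | e = long-beyond (ℕP.≤∧≢⇒< (<ᵇ-false⁻¹ s) (span≢n y y<my ∘ sym)) (side (trans (sym e) h))
    where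
    side : beyond y p ≡ true → (pos p < pos y) ⊎ (pos (m y) < pos p)
    side b with pos p <ᵇ pos y in e₁
    ... | true = inj₁ (<ᵇ-true⁻¹ e₁)
    ... | false = inj₂ (<ᵇ-true⁻¹ b)

  behind⇒hidden : ∀ y p → pos y < pos (m y) → Behind y p → hidden n m y p ≡ true
  behind⇒hidden y p y<my (short-inside s y<p p<my) =
    trans (hidden-rep y y<my p) (trans (cong (λ b → if b then inside y p else beyond y p) (<ᵇ-true s))
                                       (cong₂ _∧_ (<ᵇ-true y<p) (<ᵇ-true p<my)))
  behind⇒hidden y p y<my (long-beyond l side) =
    trans (hidden-rep y y<my p) (trans (cong (λ b → if b then inside y p else beyond y p) (<ᵇ-false (ℕP.<⇒≤ l))) (beyond-true side))
    where
    beyond-true : (pos p < pos y) ⊎ (pos (m y) < pos p) → beyond y p ≡ true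
    beyond-true (inj₁ p<y) = cong (_∨ (pos (m y) <ᵇ pos p)) (<ᵇ-true p<y)
    beyond-true (inj₂ my<p) = trans (cong ((pos p <ᵇ pos y) ∨_) (<ᵇ-true my<p)) (∨-zeroʳ _)

  data Relative (y r : Fin N) : Set where
    nested : pos r < pos y → pos (m y) < pos (m r) → Relative y r
    enclosing : pos y < pos r → pos (m r) < pos (m y) → Relative y r
    before : pos (m y) < pos r → Relative y r
    after : pos (m r) < pos y → Relative y r

  relative : ∀ y r → pos y < pos (m y) → pos r < pos (m r) → y ≢ r → Relative y r
  relative y r y<my r<mr y≢r with ℕP.<-cmp (pos r) (pos y)
  ... | tri≈ _ r≡y _ = ⊥-elim (y≢r (pos-injective (sym r≡y)))
  ... | tri< r<y _ _ with ℕP.<-cmp (pos y) (pos (m r))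
  ...   | tri< y<mr _ _ = nested r<y (proj₂ (partner-between r y r<mr r<y y<mr))
  ...   | tri≈ _ y≡mr _ = ⊥-elim (ℕP.<-asym r<y (subst (pos y <_) (cong pos (trans (cong m (pos-injective y≡mr)) (m-involutive r))) y<my))
  ...   | tri> _ _ mr<y = after mr<y
  relative y r y<my r<mr y≢r | tri> _ _ y<r with ℕP.<-cmp (pos r) (pos (m y))
  ...   | tri< r<my _ _ = enclosing y<r (proj₂ (partner-between y r y<my y<r r<my))
  ...   | tri≈ _ r≡my _ = ⊥-elim (ℕP.<-asym y<r (subst (pos r <_) (cong pos (trans (cong m (pos-injective r≡my)) (m-involutive y))) r<mr))
  ...   | tri> _ _ my<r = before my<r

  -- Two disjoint chords cannot both be long: that would need more than N points.
  disjoint-long : ∀ a₁ b₁ a₂ b₂ → a₁ < b₁ → b₁ < a₂ → a₂ < b₂ → b₂ < N → n < b₁ ∸ a₁ → n < b₂ ∸ a₂ → ⊥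
  disjoint-long a₁ b₁ a₂ b₂ a₁<b₁ b₁<a₂ a₂<b₂ b₂<N n<span₁ n<span₂ = ℕP.<-asym n<a₂ a₂<n
    where
    n<a₂ : n < a₂
    n<a₂ = ℕP.<-trans (ℕP.<-≤-trans n<span₁ (ℕP.m∸n≤m b₁ a₁)) b₁<a₂
    a₂<n : a₂ < n
    a₂<n = ℕP.+-cancelˡ-< n a₂ n (ℕP.<-trans (subst (n ℕ.+ a₂ <_) (ℕP.m∸n+n≡m (ℕP.<⇒≤ a₂<b₂)) (ℕP.+-monoˡ-< a₂ n<span₂))
                                             (subst (b₂ <_) N≡n+n b₂<N))

  not-hidden-self : ∀ r → pos r < pos (m r) → hidden n m r r ≡ true → ⊥
  not-hidden-self r r<mr h with behind r r r<mr h
  ... | short-inside _ r<r _ = ℕP.<-irrefl refl r<r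
  ... | long-beyond _ (inj₁ r<r) = ℕP.<-irrefl refl r<r
  ... | long-beyond _ (inj₂ mr<r) = ℕP.<-asym r<mr mr<r

  hidden-trans : ∀ r y g → pos r < pos (m r) → pos y < pos (m y) →
    hidden n m r y ≡ true → hidden n m y g ≡ true → hidden n m r g ≡ true
  hidden-trans r y g r<mr y<my h₁ h₂ = behind⇒hidden r g r<mr (go (behind r y r<mr h₁) (behind y g y<my h₂) (relative y r y<my r<mr y≢r))
    where
    open ℕP using (<-trans; <-asym)
    y≢r : y ≢ r
    y≢r refl = not-hidden-self r r<mr h₁
    go : Behind r y → Behind y g → Relative y r → Behind r g
    go (short-inside sr _ _) (short-inside _ y<g g<my) (nested r<y my<mr) = short-inside sr (<-trans r<y y<g) (<-trans g<my my<mr)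
    go (short-inside sr _ _) (long-beyond ly _) (nested r<y my<mr) =
      ⊥-elim (<-asym (<-trans ly (∸-nested-< (pos r) (pos (m r)) (pos y) (pos (m y)) r<y my<mr y<my)) sr)
    go (short-inside _ r<y _) _ (enclosing y<r _) = ⊥-elim (<-asym r<y y<r)
    go (short-inside _ r<y _) _ (before my<r) = ⊥-elim (<-asym (<-trans r<y y<my) my<r)
    go (short-inside _ _ y<mr) _ (after mr<y) = ⊥-elim (<-asym y<mr mr<y)
    go (long-beyond _ (inj₁ y<r)) _ (nested r<y _) = ⊥-elim (<-asym y<r r<y)
    go (long-beyond _ (inj₂ mr<y)) _ (nested _ my<mr) = ⊥-elim (<-asym mr<y (<-trans y<my my<mr))
    go (long-beyond lr _) (short-inside sy _ _) (enclosing y<r mr<my) =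
      ⊥-elim (<-asym lr (<-trans (∸-nested-< (pos y) (pos (m y)) (pos r) (pos (m r)) y<r mr<my r<mr) sy))
    go (long-beyond lr _) (long-beyond _ (inj₁ g<y)) (enclosing y<r _) = long-beyond lr (inj₁ (<-trans g<y y<r))
    go (long-beyond lr _) (long-beyond _ (inj₂ my<g)) (enclosing _ mr<my) = long-beyond lr (inj₂ (<-trans mr<my my<g))
    go (long-beyond lr _) (short-inside _ _ g<my) (before my<r) = long-beyond lr (inj₁ (<-trans g<my my<r))
    go (long-beyond lr _) (long-beyond ly _) (before my<r) = ⊥-elim (disjoint-long _ _ _ _ y<my my<r r<mr (pos<N (m r)) ly lr)
    go (long-beyond lr _) (short-inside _ y<g _) (after mr<y) = long-beyond lr (inj₂ (<-trans mr<y y<g))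
    go (long-beyond lr _) (long-beyond ly _) (after mr<y) = ⊥-elim (disjoint-long _ _ _ _ r<mr mr<y y<my (pos<N (m y)) lr ly)

  hidden-by-unhidden : ∀ r y g → pos r < pos (m r) → pos y < pos (m y) → y ≢ r → (∀ z → hidden n m z r ≡ false) →
    hidden n m r g ≡ true → hidden n m y g ≡ true → hidden n m r y ≡ true
  hidden-by-unhidden r y g r<mr y<my y≢r unhidden h₁ h₂ =
    behind⇒hidden r y r<mr (go (behind r g r<mr h₁) (behind y g y<my h₂) (relative y r y<my r<mr y≢r))
    where
    open ℕP using (<-trans; <-asym)
    y-hides-r : Behind y r → ⊥
    y-hides-r b with trans (sym (unhidden y)) (behind⇒hidden y r y<my b)
    ... | ()
    go : Behind r g → Behind y g → Relative y r → Behind r y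
    go (short-inside sr _ _) _ (nested r<y my<mr) = short-inside sr r<y (<-trans y<my my<mr)
    go (long-beyond _ (inj₁ g<r)) (short-inside _ y<g _) (nested r<y _) = ⊥-elim (<-asym g<r (<-trans r<y y<g))
    go (long-beyond _ (inj₂ mr<g)) (short-inside _ _ g<my) (nested _ my<mr) = ⊥-elim (<-asym mr<g (<-trans g<my my<mr))
    go (long-beyond _ _) (long-beyond ly _) (nested r<y _) = ⊥-elim (y-hides-r (long-beyond ly (inj₁ r<y)))
    go _ (short-inside sy _ _) (enclosing y<r mr<my) = ⊥-elim (y-hides-r (short-inside sy y<r (<-trans r<mr mr<my)))
    go (short-inside _ r<g _) (long-beyond _ (inj₁ g<y)) (enclosing y<r _) = ⊥-elim (<-asym r<g (<-trans g<y y<r))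
    go (short-inside _ _ g<mr) (long-beyond _ (inj₂ my<g)) (enclosing _ mr<my) = ⊥-elim (<-asym g<mr (<-trans mr<my my<g))
    go (long-beyond lr _) (long-beyond _ _) (enclosing y<r _) = long-beyond lr (inj₁ y<r)
    go (short-inside _ r<g _) (short-inside _ _ g<my) (before my<r) = ⊥-elim (<-asym r<g (<-trans g<my my<r))
    go (long-beyond lr _) (short-inside _ _ _) (before my<r) = long-beyond lr (inj₁ (<-trans y<my my<r))
    go _ (long-beyond ly _) (before my<r) = ⊥-elim (y-hides-r (long-beyond ly (inj₂ my<r)))
    go (short-inside _ _ g<mr) (short-inside _ y<g _) (after mr<y) = ⊥-elim (<-asym g<mr (<-trans mr<y y<g))
    go (long-beyond lr _) (short-inside _ _ _) (after mr<y) = long-beyond lr (inj₂ mr<y)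
    go _ (long-beyond ly _) (after mr<y) = ⊥-elim (y-hides-r (long-beyond ly (inj₁ (<-trans r<mr mr<y))))

  -- The band weight of a segment

  -- R₁ and R₂ each pick one endpoint of every edge.
  sum-orientation : (R₁ R₂ Q : Fin N → Bool) (F : Fin N → ℤ) →
    (∀ p → R₁ (m p) ≡ not (R₁ p)) → (∀ p → R₂ (m p) ≡ not (R₂ p)) → (∀ p → Q (m p) ≡ Q p) → (∀ p → F (m p) ≡ F p) →
    sum (λ p → ifz (R₁ p ∧ Q p) (F p)) ≡ sum (λ p → ifz (R₂ p ∧ Q p) (F p))
  sum-orientation R₁ R₂ Q F R₁-m R₂-m Q-m F-m = halve _ _ (trans (sym (twice R₁ R₁-m)) (twice R₂ R₂-m))
    where
    twice : ∀ R → (∀ p → R (m p) ≡ not (R p)) →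
      sum (λ p → ifz (Q p) (F p)) ≡ sum (λ p → ifz (R p ∧ Q p) (F p)) ℤ.+ sum (λ p → ifz (R p ∧ Q p) (F p))
    twice R R-m = trans (sum-cong-≗ (λ p → ifz-split (R p) (Q p) (F p)))
      (trans (∑-distrib-+ {N} _ _) (cong (ℤ._+_ (sum (λ p → ifz (R p ∧ Q p) (F p))))
        (trans (sum-cong-≗ (λ p → cong₂ (λ a f → ifz a f) (cong₂ _∧_ (sym (R-m p)) (sym (Q-m p))) (sym (F-m p))))
               (sym (sum-involution (λ p → ifz (R p ∧ Q p) (F p)) m m-involutive)))))

  module BandWeight (r : Fin N) (r<mr : pos r < pos (m r)) where

    tail : Fin N
    tail = tailE n m r

    t : ℕ
    t = pos tail

    open Rotation t (pos<N tail)

    behindR : Fin N → Bool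
    behindR = hidden n m r

    c : ℕ
    c = cwd t (pos (m tail))

    c<n : c < n
    c<n rewrite tailE-rep r r<mr with short r in s
    ... | true = subst (_< n) (sym (cwd-rep r r<mr)) (<ᵇ-true⁻¹ s)
    ... | false = <ᵇ-true⁻¹ (trans (cong (λ z → cwd (pos (m r)) z <ᵇ n) (pos-m-m r)) (trans (short-back r r<mr) (cong not s)))

    c≤N : c ≤ N
    c≤N = ℕP.<⇒≤ (ℕP.<-≤-trans c<n (ℕP.m≤m+n n (n ℕ.+ 0)))

    1≤c : 1 ≤ c
    1≤c with c in e
    ... | suc _ = s≤s z≤n
    ... | zero = ⊥-elim (pos-m≢pos tail (trans (sym (rotℕ-cwd (pos (m tail)) (pos<N (m tail)))) (trans (cong rotℕ e) rotℕ-0)))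

    k<N : ∀ k → k < c → k < N
    k<N k k<c = ℕP.<-≤-trans k<c c≤N

    hidden-rot : ∀ k → 1 ≤ k → k ≤ N → behindR (rot k) ≡ (k <ᵇ c)
    hidden-rot k 1≤k k≤N with ℕP.<-cmp k N
    ... | tri< k<N′ _ _ rewrite cwd-rot k k<N′ | <ᵇ-true {0} {k} 1≤k = refl
    ... | tri≈ _ refl _ rewrite toℕ-rot-N | ≤ᵇ-true (ℕP.≤-refl {t}) | ℕP.n∸n≡0 t = sym (<ᵇ-false c≤N)
    ... | tri> _ _ N<k = ⊥-elim (ℕP.<⇒≱ N<k k≤N)

    μ : ℕ → ℕ
    μ k = cwd t (pos (m (rot k)))

    behind-rot : ∀ k → 1 ≤ k → k < c → behindR (rot k) ≡ true
    behind-rot k 1≤k k<c = trans (hidden-rot k 1≤k (ℕP.<⇒≤ (k<N k k<c))) (<ᵇ-true k<c)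

    μ-range : ∀ k → 1 ≤ k → k < c → (1 ≤ μ k) × (μ k < c)
    μ-range k 1≤k k<c =
      let (1≤μk , μk<c) = ∧-true⁻¹ (trans (hidden-m r r<mr (rot k)) (behind-rot k 1≤k k<c))
      in <ᵇ-true⁻¹ 1≤μk , <ᵇ-true⁻¹ μk<c

    μ-involutive : ∀ k → 1 ≤ k → k < c → μ (μ k) ≡ k
    μ-involutive k _ k<c = trans (cong (λ z → cwd t (pos (m z))) (rot-cwd (m (rot k))))
                                 (trans (cong (cwd t ∘ pos) (m-involutive (rot k))) (cwd-rot k (k<N k k<c)))

    μ-fixfree : ∀ k → 1 ≤ k → k < c → μ k ≢ k
    μ-fixfree k _ _ e = proj₁ (proj₂ ncpm) (rot k) (trans (sym (rot-cwd (m (rot k)))) (cong rot e))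

    opens : Fin N → Bool
    opens p = cwd t (pos p) <ᵇ cwd t (pos (m p))

    phiSeg≡ : phiSeg n m r ≡ map (λ k → k <ᵇ μ k) (range 1 (c ∸ 1))
    phiSeg≡ = trans (cong (map opens) (keep-traversal behindR c 1≤c c≤N hidden-rot))
      (trans (sym (map-∘ (range 1 (c ∸ 1))))
             (map-cong-range 1 (c ∸ 1) (λ k _ k<c → cong (_<ᵇ μ k) (cwd-rot k (k<N k (subst (k <_) (ℕP.m+[n∸m]≡n 1≤c) k<c))))))

    open ArcWord c μ μ-range μ-involutive μ-fixfree using (bandWeight-arcWord)

    upAtOdd : Fin N → ℤ
    upAtOdd p = 𝟙 (behindR p ∧ opens p ∧ not (even (cwd t (pos p))))

    sum-upAtOdd : sum upAtOdd ≡ sumTo (c ∸ 1) (λ i → 𝟙 (((i ℕ.+ 1) <ᵇ μ (i ℕ.+ 1)) ∧ even i))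
    sum-upAtOdd = begin
      sum upAtOdd
        ≡⟨ sum-rot upAtOdd ⟩
      sumTo N (upAtOdd ∘ rot)
        ≡⟨ cong (λ z → sumTo z (upAtOdd ∘ rot)) N≡ ⟩
      upAtOdd (rot 0) ℤ.+ sumTo ((c ∸ 1) ℕ.+ (N ∸ c)) (upAtOdd ∘ rot ∘ suc)
        ≡⟨ cong₂ ℤ._+_ at-tail (sumTo-+ (c ∸ 1) (N ∸ c) (upAtOdd ∘ rot ∘ suc)) ⟩
      + 0 ℤ.+ (sumTo (c ∸ 1) (upAtOdd ∘ rot ∘ suc) ℤ.+ sumTo (N ∸ c) (λ i → upAtOdd (rot (suc ((c ∸ 1) ℕ.+ i)))))
        ≡⟨ ℤP.+-identityˡ _ ⟩
      sumTo (c ∸ 1) (upAtOdd ∘ rot ∘ suc) ℤ.+ sumTo (N ∸ c) (λ i → upAtOdd (rot (suc ((c ∸ 1) ℕ.+ i))))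
        ≡⟨ cong₂ ℤ._+_ (sumTo-cong (c ∸ 1) (λ i i<c-1 → in-arc i (subst (suc (suc i) ≤_) (ℕP.m+[n∸m]≡n 1≤c) (s≤s i<c-1))))
                       (sumTo-zero (N ∸ c) _ beyond-arc) ⟩
      sumTo (c ∸ 1) (λ i → 𝟙 (((i ℕ.+ 1) <ᵇ μ (i ℕ.+ 1)) ∧ even i)) ℤ.+ + 0
        ≡⟨ ℤP.+-identityʳ _ ⟩
      sumTo (c ∸ 1) (λ i → 𝟙 (((i ℕ.+ 1) <ᵇ μ (i ℕ.+ 1)) ∧ even i)) ∎
      where
      open ≡-Reasoning
      N≡ : N ≡ suc ((c ∸ 1) ℕ.+ (N ∸ c))
      N≡ = trans (sym (ℕP.m+[n∸m]≡n c≤N)) (cong (ℕ._+ (N ∸ c)) (sym (ℕP.m+[n∸m]≡n 1≤c)))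
      at-tail : upAtOdd (rot 0) ≡ + 0
      at-tail rewrite cwd-rot 0 (ℕP.<-≤-trans 1≤c c≤N) = refl
      in-arc : ∀ i → suc i < c → upAtOdd (rot (suc i)) ≡ 𝟙 (((i ℕ.+ 1) <ᵇ μ (i ℕ.+ 1)) ∧ even i)
      in-arc i i+1<c rewrite ℕP.+-comm i 1 | behind-rot (suc i) (s≤s z≤n) i+1<c | cwd-rot (suc i) (k<N (suc i) i+1<c)
                           | even-suc i | not-involutive (even i) = refl
      k≡ : ∀ i → suc ((c ∸ 1) ℕ.+ i) ≡ c ℕ.+ i
      k≡ i = cong (ℕ._+ i) (ℕP.m+[n∸m]≡n 1≤c)
      c≤k : ∀ i → c ≤ suc ((c ∸ 1) ℕ.+ i)
      c≤k i = subst (c ≤_) (sym (k≡ i)) (ℕP.m≤m+n c i)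
      k≤N : ∀ i → i < N ∸ c → suc ((c ∸ 1) ℕ.+ i) ≤ N
      k≤N i i<N-c = subst (_≤ N) (sym (k≡ i)) (ℕP.<⇒≤ (subst (c ℕ.+ i <_) (ℕP.m+[n∸m]≡n c≤N) (ℕP.+-monoʳ-< c i<N-c)))
      beyond-arc : ∀ i → i < N ∸ c → upAtOdd (rot (suc ((c ∸ 1) ℕ.+ i))) ≡ + 0
      beyond-arc i i<N-c rewrite hidden-rot (suc ((c ∸ 1) ℕ.+ i)) (s≤s z≤n) (k≤N i i<N-c)
                               | <ᵇ-false {suc ((c ∸ 1) ℕ.+ i)} {c} (c≤k i) = refl

    tailParityDiffers : Fin N → ℤ
    tailParityDiffers g = 𝟙 (even (pos (tailE n m g)) xor even t)

    opens-m : ∀ p → opens (m p) ≡ not (opens p)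
    opens-m p rewrite m-involutive p =
      <ᵇ-flip (cwd t (pos p)) (cwd t (pos (m p))) (λ e → pos-m≢pos p (cong pos (trans (sym (rot-cwd (m p))) (trans (cong rot (sym e)) (rot-cwd p)))))

    -- An edge behind r is short: its endpoints are less than c < n apart.
    tailE-opens : ∀ p → behindR p ≡ true → opens p ≡ true → tailE n m p ≡ p
    tailE-opens p behind opening = cong (λ b → if b then p else m p) (<ᵇ-true span<n)
      where
      k = cwd t (pos p)
      j = cwd t (pos (m p))
      j<c : j < c
      j<c = <ᵇ-true⁻¹ (proj₂ (∧-true⁻¹ (trans (hidden-m r r<mr p) behind)))
      span<n : cwd (pos p) (pos (m p)) < n
      span<n = subst (_< n) (sym (trans (cong₂ cwd (sym (rotℕ-cwd (pos p) (pos<N p))) (sym (rotℕ-cwd (pos (m p)) (pos<N (m p)))))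
                                        (cwd-rotℕ-rotℕ k j (<ᵇ-true⁻¹ opening) (k<N j j<c))))
                     (ℕP.≤-<-trans (ℕP.m∸n≤m j k) (ℕP.<-trans j<c c<n))

    opens-term : ∀ p → ifz (opens p ∧ behindR p) (tailParityDiffers p) ≡ upAtOdd p
    opens-term p with opens p in eo | behindR p in eb
    ... | true | true rewrite tailE-opens p eb eo | even-cwd N-even (pos p) (pos<N p) | not-involutive (even (pos p) xor even t) = refl
    ... | true | false = refl
    ... | false | true = refl
    ... | false | false = refl

    bandWeight≡ : + bandWeight (phiSeg n m r) ≡ sum (λ g → ifz (rep g ∧ behindR g) (tailParityDiffers g))
    bandWeight≡ = begin
      + bandWeight (phiSeg n m r)
        ≡⟨ cong (+_ ∘ bw 0) phiSeg≡ ⟩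
      + bw 0 (map (λ k → k <ᵇ μ k) (range 1 (c ∸ 1)))
        ≡⟨ bandWeight-arcWord 1≤c ⟩
      sumTo (c ∸ 1) (λ i → 𝟙 (((i ℕ.+ 1) <ᵇ μ (i ℕ.+ 1)) ∧ even i))
        ≡⟨ sym sum-upAtOdd ⟩
      sum upAtOdd
        ≡⟨ sym (sum-cong-≗ opens-term) ⟩
      sum (λ p → ifz (opens p ∧ behindR p) (tailParityDiffers p))
        ≡⟨ sum-orientation opens rep behindR tailParityDiffers opens-m rep-m (hidden-m r r<mr)
                           (λ p → cong (λ T → 𝟙 (even (pos T) xor even t)) (tailE-m p)) ⟩
      sum (λ g → ifz (rep g ∧ behindR g) (tailParityDiffers g)) ∎
      where open ≡-Reasoning

  -- Visible edges

  module VisibleEdge (x : Fin N) (visible : Visible n m x) where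

    r : Fin N
    r = leftEnd x

    r<mr : pos r < pos (m r)
    r<mr = leftEnd-rep x

    r-unhidden : ∀ y → hidden n m y r ≡ false
    r-unhidden y with leftEnd-cases x
    ... | inj₁ e = trans (cong (hidden n m y) e) (proj₁ (visible y))
    ... | inj₂ e = trans (cong (hidden n m y) e) (proj₂ (visible y))

    cover≡ : ∀ g → pos g < pos (m g) → cover g ≡ 𝟙-negative g ℤ.- 𝟙-negative r
    cover≡ g g<mg = begin
      cover g                                         ≡⟨ a≡a+c-c (cover g) longCorrection ⟩
      cover g ℤ.+ longCorrection ℤ.- longCorrection   ≡⟨ cong₂ ℤ._-_ (cover+longCorrection g g<mg) longCorrection≡ ⟩
      𝟙-negative g ℤ.- 𝟙-negative r                   ∎
      where
      open ≡-Reasoning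
      a≡a+c-c : ∀ a c → a ≡ a ℤ.+ c ℤ.- c
      a≡a+c-c = solve-∀
      cover-r : cover r ≡ + 0
      cover-r = sum-zero _ (λ y → trans (cong (λ h → ifz (rep y ∧ h) (sgn n m y)) (r-unhidden y)) (ifz-∧false (rep y) _))
      longCorrection≡ : longCorrection ≡ 𝟙-negative r
      longCorrection≡ = trans (sym (ℤP.+-identityˡ _)) (trans (cong (ℤ._+ longCorrection) (sym cover-r)) (cover+longCorrection r r<mr))

    tailE-x : tailE n m x ≡ tailE n m r
    tailE-x = tailE-leftEnd x

    -- As cover g = 𝟙-negative g − 𝟙-negative r, every term of the weight has the sign of −𝟙-negative r.
    weight-nonpos : 𝟙-negative r ≡ + 1 → weight n m ℤ.≤ + 0
    weight-nonpos e = subst (ℤ._≤ + 0) (sym weight≡sum-cover) (sum-nonpos _ term)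
      where
      term : ∀ g → ifz (rep g) (cover g) ℤ.≤ + 0
      term g with rep g in eg
      ... | false = ℤP.≤-refl
      ... | true rewrite cover≡ g (<ᵇ-true⁻¹ eg) | e with not (even (pos (tailE n m g)))
      ...   | true = ℤP.≤-refl
      ...   | false = ℤ.-≤+

    weight-nonneg : 𝟙-negative r ≡ + 0 → + 0 ℤ.≤ weight n m
    weight-nonneg e = subst (+ 0 ℤ.≤_) (sym weight≡sum-cover) (sum-nonneg _ term)
      where
      term : ∀ g → + 0 ℤ.≤ ifz (rep g) (cover g)
      term g with rep g in eg
      ... | false = ℤP.≤-refl
      ... | true rewrite cover≡ g (<ᵇ-true⁻¹ eg) | e with not (even (pos (tailE n m g)))
      ...   | true = ℤ.+≤+ z≤n
      ...   | false = ℤP.≤-refl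

    tail-even-if-positive : + 0 ℤ.< weight n m → even (pos (tailE n m r)) ≡ true
    tail-even-if-positive w>0 with even (pos (tailE n m r)) in e
    ... | true = refl
    ... | false = ⊥-elim (ℤP.<-irrefl refl (ℤP.<-≤-trans w>0 (weight-nonpos (cong (𝟙 ∘ not) e))))

    tail-odd-if-negative : weight n m ℤ.< + 0 → even (pos (tailE n m r)) ≡ false
    tail-odd-if-negative w<0 with even (pos (tailE n m r)) in e
    ... | false = refl
    ... | true = ⊥-elim (ℤP.<-irrefl refl (ℤP.≤-<-trans (weight-nonneg (cong (𝟙 ∘ not) e)) w<0))

    behindR : Fin N → Bool
    behindR = hidden n m r

    segmentCover : Fin N → ℤ
    segmentCover g = sum (λ y → ifz ((rep y ∧ behindR y) ∧ hidden n m y g) (sgn n m y))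

    -- The edges hiding a point behind r are r itself and the edges of the segment hiding it.
    cover-term-in-segment : ∀ g y → pos g < pos (m g) →
      ifz ((rep y ∧ behindR y) ∧ hidden n m y g) (sgn n m y) ℤ.+ ifz (behindR g ∧ (pos y ≡ᵇ pos r)) (sgn n m y)
        ≡ ifz (behindR g) (ifz (rep y ∧ hidden n m y g) (sgn n m y))
    cover-term-in-segment g y g<mg with behindR g in eU
    ... | false = trans (ℤP.+-identityʳ _) outside-segment
      where
      outside-segment : ifz ((rep y ∧ behindR y) ∧ hidden n m y g) (sgn n m y) ≡ + 0
      outside-segment with (rep y ∧ behindR y) ∧ hidden n m y g in e
      ... | false = refl
      ... | true with ∧-true⁻¹ e
      ...   | (ry∧Uy , hy) with ∧-true⁻¹ ry∧Uy
      ...     | (ry , Uy) with trans (sym eU) (hidden-trans r y g r<mr (<ᵇ-true⁻¹ ry) Uy hy)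
      ...       | ()
    ... | true with pos y ≡ᵇ pos r in ey
    ...   | true with pos-injective {y} {r} (≡ᵇ-true⁻¹ ey)
    ...     | refl rewrite <ᵇ-true r<mr | eU with behindR r in eUr
    ...       | true = ⊥-elim (not-hidden-self r r<mr eUr)
    ...       | false = ℤP.+-identityˡ _
    cover-term-in-segment g y g<mg | true | false = trans (ℤP.+-identityʳ _) (cong (λ c → ifz c (sgn n m y)) same)
      where
      y≢r : y ≢ r
      y≢r e with trans (sym ey) (≡ᵇ-true (cong pos e))
      ... | ()
      same : (rep y ∧ behindR y) ∧ hidden n m y g ≡ rep y ∧ hidden n m y g
      same with rep y in e₁ | hidden n m y g in e₂
      ... | false | _ = refl
      ... | true | false = ∧-zeroʳ (behindR y)
      ... | true | true = cong (_∧ true) (hidden-by-unhidden r y g r<mr (<ᵇ-true⁻¹ e₁) y≢r r-unhidden eU e₂)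

    cover-in-segment : ∀ g → pos g < pos (m g) → ifz (behindR g) (sgn n m r) ℤ.+ segmentCover g ≡ ifz (behindR g) (cover g)
    cover-in-segment g g<mg = begin
      ifz (behindR g) (sgn n m r) ℤ.+ segmentCover g
        ≡⟨ ℤP.+-comm (ifz (behindR g) (sgn n m r)) (segmentCover g) ⟩
      segmentCover g ℤ.+ ifz (behindR g) (sgn n m r)
        ≡⟨ cong (ℤ._+_ (segmentCover g)) (sym only-r) ⟩
      segmentCover g ℤ.+ sum (λ y → ifz (behindR g ∧ (pos y ≡ᵇ pos r)) (sgn n m y))
        ≡⟨ sym (∑-distrib-+ {N} _ _) ⟩
      sum (λ y → ifz ((rep y ∧ behindR y) ∧ hidden n m y g) (sgn n m y) ℤ.+ ifz (behindR g ∧ (pos y ≡ᵇ pos r)) (sgn n m y))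
        ≡⟨ sum-cong-≗ (λ y → cover-term-in-segment g y g<mg) ⟩
      sum (λ y → ifz (behindR g) (ifz (rep y ∧ hidden n m y g) (sgn n m y)))
        ≡⟨ sum-ifz {N} (behindR g) _ ⟩
      ifz (behindR g) (cover g) ∎
      where
      open ≡-Reasoning
      only-r : sum (λ y → ifz (behindR g ∧ (pos y ≡ᵇ pos r)) (sgn n m y)) ≡ ifz (behindR g) (sgn n m r)
      only-r = trans (sum-single _ r others)
                     (cong (λ c → ifz c (sgn n m r)) (trans (cong (behindR g ∧_) (≡ᵇ-true {pos r} refl)) (∧-identityʳ (behindR g))))
        where
        others : ∀ y → y ≢ r → ifz (behindR g ∧ (pos y ≡ᵇ pos r)) (sgn n m y) ≡ + 0
        others y y≢r = trans (cong (λ c → ifz (behindR g ∧ c) (sgn n m y)) (≡ᵇ-false (y≢r ∘ pos-injective)))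
                             (ifz-∧false (behindR g) _)

    segWeight≡ : segWeight n m r ≡ sum (λ g → ifz (rep g ∧ behindR g) (𝟙-negative g ℤ.- 𝟙-negative r))
    segWeight≡ = begin
      segWeight n m r
        ≡⟨ cong₂ ℤ._+_ (signedLen-as-sum r true (λ _ → <ᵇ-true r<mr))
                       (sumℤ-keep (λ y → rep y ∧ behindR y ∧ behindR (m y)) (signedLen n m) (λ z → z)) ⟩
      sum (λ g → ifz (rep g) (ifz (behindR g) (sgn n m r))) ℤ.+ sum (λ y → ifz (rep y ∧ behindR y ∧ behindR (m y)) (signedLen n m y))
        ≡⟨ cong (ℤ._+_ (sum (λ g → ifz (rep g) (ifz (behindR g) (sgn n m r))))) segment ⟩
      sum (λ g → ifz (rep g) (ifz (behindR g) (sgn n m r))) ℤ.+ sum (λ g → ifz (rep g) (segmentCover g))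
        ≡⟨ sym (∑-distrib-+ {N} _ _) ⟩
      sum (λ g → ifz (rep g) (ifz (behindR g) (sgn n m r)) ℤ.+ ifz (rep g) (segmentCover g))
        ≡⟨ sum-cong-≗ term ⟩
      sum (λ g → ifz (rep g ∧ behindR g) (𝟙-negative g ℤ.- 𝟙-negative r)) ∎
      where
      open ≡-Reasoning
      both-ends : ∀ y → rep y ∧ behindR y ∧ behindR (m y) ≡ rep y ∧ behindR y
      both-ends y rewrite hidden-m r r<mr y with rep y | behindR y
      ... | true | true = refl
      ... | true | false = refl
      ... | false | _ = refl
      segment : sum (λ y → ifz (rep y ∧ behindR y ∧ behindR (m y)) (signedLen n m y)) ≡ sum (λ g → ifz (rep g) (segmentCover g))
      segment = begin
        sum (λ y → ifz (rep y ∧ behindR y ∧ behindR (m y)) (signedLen n m y))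
          ≡⟨ sum-cong-≗ (λ y → cong (λ c → ifz c (signedLen n m y)) (both-ends y)) ⟩
        sum (λ y → ifz (rep y ∧ behindR y) (signedLen n m y))
          ≡⟨ sum-cong-≗ (λ y → signedLen-as-sum y (rep y ∧ behindR y) (proj₁ ∘ ∧-true⁻¹)) ⟩
        sum (λ y → sum (λ g → ifz (rep g) (ifz ((rep y ∧ behindR y) ∧ hidden n m y g) (sgn n m y))))
          ≡⟨ ∑-comm (λ y g → ifz (rep g) (ifz ((rep y ∧ behindR y) ∧ hidden n m y g) (sgn n m y))) ⟩
        sum (λ g → sum (λ y → ifz (rep g) (ifz ((rep y ∧ behindR y) ∧ hidden n m y g) (sgn n m y))))
          ≡⟨ sum-cong-≗ (λ g → sum-ifz (rep g) (λ y → ifz ((rep y ∧ behindR y) ∧ hidden n m y g) (sgn n m y))) ⟩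
        sum (λ g → ifz (rep g) (segmentCover g)) ∎
      term : ∀ g → ifz (rep g) (ifz (behindR g) (sgn n m r)) ℤ.+ ifz (rep g) (segmentCover g)
                   ≡ ifz (rep g ∧ behindR g) (𝟙-negative g ℤ.- 𝟙-negative r)
      term g with rep g in eg
      ... | false = refl
      ... | true = trans (cover-in-segment g (<ᵇ-true⁻¹ eg)) (cong (ifz (behindR g)) (cover≡ g (<ᵇ-true⁻¹ eg)))

    open BandWeight r r<mr using (tailParityDiffers; bandWeight≡)

    segWeightFrom : Fin N → ℤ
    segWeightFrom T = (signOf (pos T) ℤ.* + (countEdges n m (hiddenFrom T) ⊓ countEdges n m (outsideFrom T)))
      ℤ.+ sumℤ (map (signedLen n m) (keep (λ y → rep y ∧ hiddenFrom T y ∧ hiddenFrom T (m y)) (allFin N)))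

    phiSegFrom : Fin N → List Bool
    phiSegFrom T = map (λ p → cwd (pos T) (pos p) <ᵇ cwd (pos T) (pos (m p)))
      (keep (hiddenFrom T) (keep (λ p → pos T <ᵇ pos p) (allFin N) ++ keep (λ p → pos p ≤ᵇ pos T) (allFin N)))

    segWeight≡sgn*bandWeight : segWeight n m x ≡ sgn n m x ℤ.* + bandWeight (phiSeg n m x)
    segWeight≡sgn*bandWeight = begin
      segWeight n m x
        ≡⟨ cong segWeightFrom tailE-x ⟩
      segWeight n m r
        ≡⟨ segWeight≡ ⟩
      sum (λ g → ifz (rep g ∧ behindR g) (𝟙-negative g ℤ.- 𝟙-negative r))
        ≡⟨ sum-cong-≗ (λ g → trans (cong (ifz (rep g ∧ behindR g)) (𝟙-not-difference (even (pos (tailE n m g))) (even (pos (tailE n m r)))))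
                                   (ifz-* (rep g ∧ behindR g) (sgn n m r) (tailParityDiffers g))) ⟩
      sum (λ g → sgn n m r ℤ.* ifz (rep g ∧ behindR g) (tailParityDiffers g))
        ≡⟨ sym (*-distribˡ-sum (sgn n m r) (λ g → ifz (rep g ∧ behindR g) (tailParityDiffers g))) ⟩
      sgn n m r ℤ.* sum (λ g → ifz (rep g ∧ behindR g) (tailParityDiffers g))
        ≡⟨ cong₂ ℤ._*_ (cong (signOf ∘ pos) (sym tailE-x)) (sym bandWeight≡) ⟩
      sgn n m x ℤ.* + bandWeight (phiSeg n m r)
        ≡⟨ cong (λ T → sgn n m x ℤ.* + bandWeight (phiSegFrom T)) (sym tailE-x) ⟩
      sgn n m x ℤ.* + bandWeight (phiSeg n m x) ∎
      where open ≡-Reasoning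

    sgn-if-positive : + 0 ℤ.< weight n m → sgn n m x ≡ + 1
    sgn-if-positive w>0 = trans (cong (signOf ∘ pos) tailE-x) (cong (λ b → if b then + 1 else - (+ 1)) (tail-even-if-positive w>0))

    sgn-if-negative : weight n m ℤ.< + 0 → sgn n m x ≡ - (+ 1)
    sgn-if-negative w<0 = trans (cong (signOf ∘ pos) tailE-x) (cong (λ b → if b then + 1 else - (+ 1)) (tail-odd-if-negative w<0))

open import Data.Nat using (ℕ; _≤_; _*_)
open import Data.Nat.Divisibility using (_∣_)
open import Data.Fin using (Fin)
open import Data.Integer using (ℤ; +_; -_; _<_)
open import Data.Product using (_×_; _,_)
open import Relation.Binary.PropositionalEquality using (_≡_; _≢_; cong; trans)
import Data.Integer as ℤ
import Data.Integer.Properties as ℤP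

lemma19 : (n : ℕ) → 2 ≤ n → 2 ∣ n →
    (m : Fin (2 * n) → Fin (2 * n)) → IsNCPM n m → weight n m ≢ + 0 →
    ((+ 0 < weight n m) →
      ∀ x → Visible n m x →
        (sgn n m x ≡ + 1) × (segWeight n m x ≡ + bandWeight (phiSeg n m x)))
    ×
    ((weight n m < + 0) →
      ∀ x → Visible n m x →
        (sgn n m x ≡ - (+ 1)) × (segWeight n m x ≡ - (+ bandWeight (phiSeg n m x))))
lemma19 n _ 2∣n m ncpm _ = positive , negative
  where
  open NonCrossingMatching n (even-if-2∣ 2∣n) m ncpm

  positive : + 0 < weight n m → ∀ x → Visible n m x →
    (sgn n m x ≡ + 1) × (segWeight n m x ≡ + bandWeight (phiSeg n m x))
  positive w>0 x visible = sgn≡ , trans segWeight≡sgn*bandWeight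
    (trans (cong (ℤ._* + bandWeight (phiSeg n m x)) sgn≡) (ℤP.*-identityˡ _))
    where
    open VisibleEdge x visible
    sgn≡ : sgn n m x ≡ + 1
    sgn≡ = sgn-if-positive w>0

  negative : weight n m < + 0 → ∀ x → Visible n m x →
    (sgn n m x ≡ - (+ 1)) × (segWeight n m x ≡ - (+ bandWeight (phiSeg n m x)))
  negative w<0 x visible = sgn≡ , trans segWeight≡sgn*bandWeight
    (trans (cong (ℤ._* + bandWeight (phiSeg n m x)) sgn≡) (ℤP.-1*i≡-i _))
    where
    open VisibleEdge x visible
    sgn≡ : sgn n m x ≡ - (+ 1)
    sgn≡ = sgn-if-negative w<0
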